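{- Let $m,n$ be coprime positive integers with $m>n$. Then the coefficient of $F_{[n-1]}(X)$ in the Hikita polynomial $\mathcal H_{m,n}(X;q,t)$ (expanded in the fundamental quasisymmetric functions $F_S(X)$, $S\subseteq[n-1]$) equals the rational $q,t$-Catalan polynomial $C_{m-n,n}(q,t)$.
   Context: For coprime positive integers $a,n$: the $(a,n)$-diagram consists of the unit cells $(u,v)$, $1\le u\le a$, $1\le v\le n$, where cell $(u,v)$ is the unit square in $[0,a]\times[0,n]$ with northeast corner $(u,v)$. The rank of cell $(u,v)$ is $\gamma(u,v)=an-un-(n+1-v)a$. An $(a,n)$-Dyck path $\pi$ is a lattice path from $(0,0)$ to $(a,n)$ with unit north and east steps never going strictly below the line $y=\frac{n}{a}x$. Cells northwest of the path are "above the path", the others "below the path". For each north step, the cell whose western edge is that step is "on the path"; $R(\pi)$ is the set of the $n$ ranks of these cells. $\mathrm{area}(\pi)$ is the number of cells below $\pi$ with positive rank. For a cell $c$ above $\pi$, $\mathrm{arm}(c)$ (resp. $\mathrm{leg}(c)$) is the number of cells above $\pi$ strictly east of $c$ in its row (resp. strictly south of $c$ in its column); $c$ is a dinv cell if $\frac{\mathrm{arm}(c)}{\mathrm{leg}(c)+1}<\frac{a}{n}<\frac{\mathrm{arm}(c)+1}{\mathrm{leg}(c)}$ (division by $0$ is $+\infty$); $\mathrm{dinv}(\pi)$ is the number of dinv cells. The rational $q,t$-Catalan polynomial is $C_{a,n}(q,t)=\sum_\pi q^{\mathrm{dinv}(\pi)}t^{\mathrm{area}(\pi)}$ over all $(a,n)$-Dyck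 paths. Parking functions: an $(m,n)$-parking function is a pair $P=(\pi,W)$ with $\pi$ an $(m,n)$-Dyck path and $W=(w_1,\dots,w_n)$ an ordering of $R(\pi)$ such that whenever $k,k+m\in R(\pi)$, $k$ appears left of $k+m$ in $W$. Set $\mathrm{area}(P)=\mathrm{area}(\pi)$, $\mathrm{des}(P)=\{i\in[n-1]:w_i>w_{i+1}\}$, $\mathrm{inv}(P)=\#\{(i,j):1\le i<j\le n,\ w_j<w_i<w_j+m\}$, $\mathrm{dinv}(P)=\mathrm{dinv}(\pi)-\mathrm{inv}(P)$. Fundamental quasisymmetric functions (convention used here): for $S\subseteq[n-1]$, $F_S(X)=\sum x_{i_1}\cdots x_{i_n}$ over $i_1\le\cdots\le i_n$ with $i_j<i_{j+1}$ whenever $j\notin S$. The Hikita polynomial is $\mathcal H_{m,n}(X;q,t)=\sum_P t^{\mathrm{area}(P)}q^{\mathrm{dinv}(P)}F_{\mathrm{des}(P)}(X)$ over all $(m,n)$-parking functions $P$. -}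

module Defs where

open import Data.Bool using (Bool; true; false; not; _∧_; _∨_; if_then_else_)
open import Data.Nat as ℕ using (ℕ; zero; suc; _∸_; _≤ᵇ_; _<ᵇ_; _≡ᵇ_)
open import Data.Integer as ℤ using (ℤ; +_)
open import Data.List using (List; []; _∷_; map; concatMap; filterᵇ; length; upTo; replicate; foldr)
open import Data.List.Properties using (≡-dec)
open import Data.Product using (_×_; _,_; proj₁; proj₂)
open import Relation.Nullary using (does)
import Data.Bool.Properties as BoolP

-- Lattice paths: list of steps, true = north step, false = east step.
Path : Set
Path = List Bool

allPaths : ℕ → List Path
allPaths zero = [] ∷ []
allPaths (suc k) = concatMap (λ p → (true ∷ p) ∷ (false ∷ p) ∷ []) (allPaths k)

countTrue : List Bool → ℕ
countTrue [] = 0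
countTrue (true ∷ bs) = suc (countTrue bs)
countTrue (false ∷ bs) = countTrue bs

aboveLineFrom : ℕ → ℕ → ℕ → ℕ → Path → Bool
aboveLineFrom a n x y [] = (n ℕ.* x) ≤ᵇ (a ℕ.* y)
aboveLineFrom a n x y (true ∷ p) = ((n ℕ.* x) ≤ᵇ (a ℕ.* y)) ∧ aboveLineFrom a n x (suc y) p
aboveLineFrom a n x y (false ∷ p) = ((n ℕ.* x) ≤ᵇ (a ℕ.* y)) ∧ aboveLineFrom a n (suc x) y p

isDyck : ℕ → ℕ → Path → Bool
isDyck a n p = (length p ≡ᵇ (a ℕ.+ n)) ∧ (countTrue p ≡ᵇ n) ∧ aboveLineFrom a n 0 0 p

dyckPaths : ℕ → ℕ → List Path
dyckPaths a n = filterᵇ (isDyck a n) (allPaths (a ℕ.+ n))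

northXsFrom : ℕ → Path → List ℕ
northXsFrom x [] = []
northXsFrom x (true ∷ p) = x ∷ northXsFrom x p
northXsFrom x (false ∷ p) = northXsFrom (suc x) p

northXs : Path → List ℕ
northXs = northXsFrom 0

-- 1-indexed lookup with default 0
at : List ℕ → ℕ → ℕ
at [] _ = 0
at (x ∷ xs) zero = 0
at (x ∷ xs) (suc zero) = x
at (x ∷ xs) (suc (suc k)) = at xs (suc k)

range1 : ℕ → List ℕ
range1 k = map suc (upTo k)

-- cells (u,v), 1 ≤ u ≤ a, 1 ≤ v ≤ n (northeast corner (u,v))
cells : ℕ → ℕ → List (ℕ × ℕ)
cells a n = concatMap (λ u → map (λ v → (u , v)) (range1 n)) (range1 a)

rank : ℕ → ℕ → ℕ → ℕ → ℤ
rank a n u v = (+ (a ℕ.* n) ℤ.- + (u ℕ.* n)) ℤ.- + ((suc n ∸ v) ℕ.* a)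

count : {A : Set} → (A → Bool) → List A → ℕ
count p xs = length (filterᵇ p xs)

-- cell (u,v) lies above (northwest of) the path iff u ≤ x-coordinate of the north step in row v
isAbove : Path → ℕ × ℕ → Bool
isAbove p (u , v) = u ≤ᵇ at (northXs p) v

area : ℕ → ℕ → Path → ℕ
area a n p = count (λ c → not (isAbove p c) ∧ does (+ 0 ℤ.<? rank a n (proj₁ c) (proj₂ c))) (cells a n)

arm : ℕ → ℕ → Path → ℕ × ℕ → ℕ
arm a n p (u , v) = count (λ u' → (u ℕ.<ᵇ u') ∧ isAbove p (u' , v)) (range1 a)

leg : ℕ → ℕ → Path → ℕ × ℕ → ℕ
leg a n p (u , v) = count (λ v' → (v' ℕ.<ᵇ v) ∧ isAbove p (u , v')) (range1 n)

-- arm/(leg+1) < a/n < (arm+1)/leg  (x/0 = +∞), cross-multiplied (all quantities positive)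
isDinvCell : ℕ → ℕ → Path → ℕ × ℕ → Bool
isDinvCell a n p c =
  isAbove p c
  ∧ ((arm a n p c ℕ.* n) <ᵇ (a ℕ.* suc (leg a n p c)))
  ∧ ((leg a n p c ≡ᵇ 0) ∨ ((a ℕ.* leg a n p c) <ᵇ (n ℕ.* suc (arm a n p c))))

dinv : ℕ → ℕ → Path → ℕ
dinv a n p = count (isDinvCell a n p) (cells a n)

-- Polynomials in q (Laurent, exponent in ℤ) and t with ℕ coefficients are represented
-- by the list of their monomials (q-exponent , t-exponent) with multiplicity;
-- two polynomials are equal iff the lists are permutations of each other.
Monomial : Set
Monomial = ℤ × ℕ

catalan : ℕ → ℕ → List Monomial
catalan a n = map (λ p → (+ dinv a n p , area a n p)) (dyckPaths a n)

rankList : ℕ → ℕ → Path → List ℤ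
rankList a n p = map (λ v → rank a n (suc (at (northXs p) v)) v) (range1 n)

insertAll : {A : Set} → A → List A → List (List A)
insertAll x [] = (x ∷ []) ∷ []
insertAll x (y ∷ ys) = (x ∷ y ∷ ys) ∷ map (y ∷_) (insertAll x ys)

perms : {A : Set} → List A → List (List A)
perms [] = [] ∷ []
perms (x ∷ xs) = concatMap (insertAll x) (perms xs)

eqℤ : ℤ → ℤ → Bool
eqℤ x y = does (x ℤ.≟ y)

elemℤ : ℤ → List ℤ → Bool
elemℤ k = foldr (λ x b → eqℤ k x ∨ b) false

leftOf : ℤ → ℤ → List ℤ → Bool
leftOf k k' [] = false
leftOf k k' (w ∷ ws) = if eqℤ w k then true else (if eqℤ w k' then false else leftOf k k' ws)

validWord : ℕ → List ℤ → List ℤ → Bool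
validWord m R W = foldr (λ k b → (not (elemℤ (k ℤ.+ + m) R) ∨ leftOf k (k ℤ.+ + m) W) ∧ b) true R

parkingFunctions : ℕ → ℕ → List (Path × List ℤ)
parkingFunctions m n =
  concatMap (λ p → map (λ W → (p , W)) (filterᵇ (validWord m (rankList m n p)) (perms (rankList m n p))))
            (dyckPaths m n)

inv : ℕ → List ℤ → ℕ
inv m [] = 0
inv m (w ∷ ws) = count (λ w' → does (w' ℤ.<? w) ∧ does (w ℤ.<? w' ℤ.+ + m)) ws ℕ.+ inv m ws

-- descent set of W, encoded as a list of n-1 booleans (entry i true iff i ∈ des)
desList : List ℤ → List Bool
desList [] = []
desList (x ∷ []) = []
desList (x ∷ y ∷ r) = does (y ℤ.<? x) ∷ desList (y ∷ r)

-- subsets S ⊆ [n-1] are encoded as boolean lists of length n-1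
Subset : Set
Subset = List Bool

fullSet : ℕ → Subset
fullSet n = replicate (n ∸ 1) true

-- coefficient of F_S(X) in the Hikita polynomial H_{m,n}(X;q,t):
-- Σ_{P : des(P) = S} q^{dinv(P)} t^{area(P)}, dinv(P) = dinv(π) - inv(P)
hikitaCoeff : ℕ → ℕ → Subset → List Monomial
hikitaCoeff m n S =
  map (λ P → (+ dinv m n (proj₁ P) ℤ.- + inv m (proj₂ P) , area m n (proj₁ P)))
      (filterᵇ (λ P → does (≡-dec BoolP._≟_ (desList (proj₂ P)) S)) (parkingFunctions m n))

-- A parking function with descent set [n−1] has a strictly decreasing word. The ranks of the
-- north steps of a path are distinct because m and n are coprime, so each (m,n)-Dyck path π carries
-- exactly one decreasing arrangement W of R(π), and W is admissible iff R(π) contains no pair k, k + m.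
-- Rank arithmetic shows that this happens exactly when every north step of π is followed by an east
-- step, i.e. when π is obtained from an (m−n,n)-Dyck path q by inserting an east step after each north
-- step. Then area π = area q, row by row. For dinv, the cells above π in row k+1 fall into blocks
-- according to their leg; comparing each block with the corresponding block of q, π has one extra dinv
-- cell for every pair of rows whose ranks differ by less than m, up to boundary terms that telescope.
-- Hence dinv π = dinv q + inv W, and the monomial of (π, W) is q^{dinv q} t^{area q}.

module Submission where

open import Defs
open import Data.Nat using (ℕ; _<_; NonZero)
open import Data.Nat.Coprimality using (Coprime)
open import Data.List.Relation.Binary.Permutation.Propositional using (_↭_)
open import Data.Nat using (_∸_)

open import Data.Bool using (Bool; true; false; not; _∧_; _∨_; T; if_then_else_)
open import Data.Bool.Properties as Bool using (∧-assoc; ∧-comm; ∧-zeroʳ; ∧-identityʳ; T-≡)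
open import Data.Empty using (⊥-elim)
open import Data.Integer as ℤ using (ℤ; +_; +<+)
import Data.Integer.Properties as ℤₚ
import Data.Integer.Tactic.RingSolver as ℤ-Solver
open import Data.List using (List; []; _∷_; map; concatMap; concat; filterᵇ; length; _++_; foldr; replicate; upTo; applyUpTo)
open import Data.List.Properties
  using (≡-dec; ∷-injectiveˡ; ∷-injectiveʳ; length-++; length-applyUpTo; filter-++; filter-all; filter-none;
         map-++; map-∘; map-cong-local; map-concatMap; map-upTo; map-applyUpTo; upTo-∷ʳ)
open import Data.List.Membership.Propositional using (_∈_; _∉_; find)
open import Data.List.Membership.Propositional.Properties
  using (∈-map⁺; ∈-map⁻; ∈-concatMap⁺; ∈-concatMap⁻; ∈-filter⁺; ∈-filter⁻; ∈-upTo⁺; ∈-upTo⁻)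
open import Data.List.Membership.Propositional.Properties.WithK using (unique∧set⇒bag)
open import Data.List.Relation.Binary.BagAndSetEquality using (∼bag⇒↭)
open import Data.List.Relation.Binary.Permutation.Propositional
  using (↭-refl; ↭-sym; ↭-trans; prep; swap; module PermutationReasoning) renaming (refl to ↭-refl′; trans to ↭-trans′)
open import Data.List.Relation.Binary.Permutation.Propositional.Properties using (↭-length; filter-↭; ∈-resp-↭; map⁺)
open import Data.List.Relation.Unary.All as All using ([]; _∷_)
open import Data.List.Relation.Unary.All.Properties using (All¬⇒¬Any)
open import Data.List.Relation.Unary.Any as Any using (here; there)
open import Data.List.Relation.Unary.Unique.Propositional using (Unique; []; _∷_)
import Data.List.Relation.Unary.Unique.Propositional.Properties as Unique
open import Data.Nat using (zero; suc; _+_; _*_; _≤_; z≤n; s≤s; _≤ᵇ_; _<ᵇ_; _≡ᵇ_; _≤?_; _<?_; >-nonZero)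
open import Data.Nat.Coprimality as Coprimality using (coprime-divisor)
open import Data.Nat.Divisibility using (_∣_; ∣⇒≤; ∣m+n∣m⇒∣n; n∣m*n)
open import Data.Nat.ListAction using (sum)
open import Data.Nat.Properties
import Data.Nat.Tactic.RingSolver as ℕ-Solver
open import Algebra.Properties.CommutativeSemigroup +-commutativeSemigroup using (interchange)
open import Data.Product using (_×_; _,_; proj₁; proj₂; ∃)
open import Data.Sum using (_⊎_; inj₁; inj₂)
open import Function using (_∘_; case_of_)
open import Function.Bundles using (_⇔_; mk⇔; Equivalence)
open import Relation.Binary.Definitions using (tri<; tri≈; tri>)
open import Relation.Binary.PropositionalEquality
open import Relation.Nullary using (¬_; Dec; yes; no; does)
open import Relation.Nullary.Decidable using (T?; dec-true; dec-false; does-⇔)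

-- Booleans, finite sums and counting

does≡true⇒ : ∀ {A : Set} (a? : Dec A) → does a? ≡ true → A
does≡true⇒ (yes a) _ = a
does≡true⇒ (no _) ()

does≡false⇒ : ∀ {A : Set} (a? : Dec A) → does a? ≡ false → ¬ A
does≡false⇒ (no ¬a) _ = ¬a
does≡false⇒ (yes _) ()

∧≡true⁻ : ∀ {b c} → (b ∧ c) ≡ true → b ≡ true × c ≡ true
∧≡true⁻ {true} c≡true = refl , c≡true

<ᵇ-cancelʳ : ∀ x y q → (x + q <ᵇ y + q) ≡ (x <ᵇ y)
<ᵇ-cancelʳ x y q = does-⇔ (mk⇔ (+-cancelʳ-< q x y) (+-monoˡ-< q)) (x + q <? y + q) (x <? y)

not-<ᵇ : ∀ x y → not (x <ᵇ y) ≡ (y ≤ᵇ x)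
not-<ᵇ x y with x <ᵇ y in x<ᵇy
... | true = sym (dec-false (y ≤? x) (<⇒≱ (does≡true⇒ (x <? y) x<ᵇy)))
... | false = sym (dec-true (y ≤? x) (≮⇒≥ (does≡false⇒ (x <? y) x<ᵇy)))

𝟙 : Bool → ℕ
𝟙 true = 1
𝟙 false = 0

∑ : ℕ → (ℕ → ℕ) → ℕ
∑ zero f = 0
∑ (suc k) f = f 0 + ∑ k (f ∘ suc)

syntax ∑ k (λ i → e) = ∑[ i < k ] e

∑-cong : ∀ {f g} k → (∀ i → i < k → f i ≡ g i) → ∑ k f ≡ ∑ k g
∑-cong zero _ = refl
∑-cong (suc k) f≡g = cong₂ _+_ (f≡g 0 (s≤s z≤n)) (∑-cong k (λ i i<k → f≡g (suc i) (s≤s i<k)))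

∑-cong′ : ∀ {f g k l} → k ≡ l → (∀ i → i < l → f i ≡ g i) → ∑ k f ≡ ∑ l g
∑-cong′ {l = l} refl = ∑-cong l

∑-zero : ∀ {f} k → (∀ i → i < k → f i ≡ 0) → ∑ k f ≡ 0
∑-zero zero _ = refl
∑-zero (suc k) f≡0 = cong₂ _+_ (f≡0 0 (s≤s z≤n)) (∑-zero k (λ i i<k → f≡0 (suc i) (s≤s i<k)))

∑-const-1 : ∀ k → ∑[ i < k ] 1 ≡ k
∑-const-1 zero = refl
∑-const-1 (suc k) = cong suc (∑-const-1 k)

∑-split : ∀ f j k → ∑ (j + k) f ≡ ∑ j f + ∑[ i < k ] f (j + i)
∑-split f zero k = refl
∑-split f (suc j) k = trans (cong (_+_ (f 0)) (∑-split (f ∘ suc) j k)) (sym (+-assoc (f 0) _ _))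

∑-snoc : ∀ f k → ∑ (suc k) f ≡ ∑ k f + f k
∑-snoc f k = begin
  ∑ (suc k) f                  ≡⟨ cong (λ l → ∑ l f) (+-comm 1 k) ⟩
  ∑ (k + 1) f                  ≡⟨ ∑-split f k 1 ⟩
  ∑ k f + (f (k + 0) + 0)      ≡⟨ cong (λ x → ∑ k f + x) (trans (+-identityʳ _) (cong f (+-identityʳ k))) ⟩
  ∑ k f + f k                  ∎
  where open ≡-Reasoning

∑-shift : ∀ f k → f 0 ≡ f k → ∑ k f ≡ ∑[ j < k ] f (suc j)
∑-shift f k f0≡fk = +-cancelʳ-≡ (f k) _ _ (begin
  ∑ k f + f k                  ≡⟨ ∑-snoc f k ⟨
  f 0 + ∑[ j < k ] f (suc j)   ≡⟨ cong (_+ ∑[ j < k ] f (suc j)) f0≡fk ⟩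
  f k + ∑[ j < k ] f (suc j)   ≡⟨ +-comm (f k) _ ⟩
  ∑[ j < k ] f (suc j) + f k   ∎)
  where open ≡-Reasoning

∑-distrib-+ : ∀ f g k → ∑[ i < k ] (f i + g i) ≡ ∑ k f + ∑ k g
∑-distrib-+ f g zero = refl
∑-distrib-+ f g (suc k) = trans (cong (_+_ (f 0 + g 0)) (∑-distrib-+ (f ∘ suc) (g ∘ suc) k))
  (interchange (f 0) (g 0) _ _)

∑-comm : ∀ (f : ℕ → ℕ → ℕ) k l → ∑[ i < k ] ∑[ j < l ] f i j ≡ ∑[ j < l ] ∑[ i < k ] f i j
∑-comm f zero l = sym (∑-zero l (λ _ _ → refl))
∑-comm f (suc k) l = trans (cong (_+_ (∑[ j < l ] f 0 j)) (∑-comm (f ∘ suc) k l))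
  (sym (∑-distrib-+ (f 0) (λ j → ∑[ i < k ] f (suc i) j) l))

∑-interval : ∀ N lo hi → lo ≤ hi → hi ≤ N → ∑[ i < N ] 𝟙 ((lo ≤ᵇ i) ∧ (i <ᵇ hi)) ≡ hi ∸ lo
∑-interval N lo hi lo≤hi hi≤N = begin
  ∑ N f                                                  ≡⟨ cong (λ l → ∑ l f) N≡ ⟨
  ∑ (lo + (hi ∸ lo) + (N ∸ hi)) f                        ≡⟨ ∑-split f (lo + (hi ∸ lo)) (N ∸ hi) ⟩
  ∑ (lo + (hi ∸ lo)) f + ∑[ i < N ∸ hi ] f (lo + (hi ∸ lo) + i)
      ≡⟨ cong₂ _+_ (∑-split f lo (hi ∸ lo)) (∑-zero (N ∸ hi) above) ⟩
  ∑ lo f + ∑[ i < hi ∸ lo ] f (lo + i) + 0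
      ≡⟨ cong (_+ 0) (cong₂ _+_ (∑-zero lo below) (trans (∑-cong (hi ∸ lo) inside) (∑-const-1 (hi ∸ lo)))) ⟩
  hi ∸ lo + 0                                            ≡⟨ +-identityʳ _ ⟩
  hi ∸ lo                                                ∎
  where
  open ≡-Reasoning
  f : ℕ → ℕ
  f i = 𝟙 ((lo ≤ᵇ i) ∧ (i <ᵇ hi))
  N≡ : lo + (hi ∸ lo) + (N ∸ hi) ≡ N
  N≡ = trans (cong (_+ (N ∸ hi)) (m+[n∸m]≡n lo≤hi)) (m+[n∸m]≡n hi≤N)
  below : ∀ i → i < lo → f i ≡ 0
  below i i<lo = cong (λ b → 𝟙 (b ∧ (i <ᵇ hi))) (dec-false (lo ≤? i) (<⇒≱ i<lo))
  inside : ∀ i → i < hi ∸ lo → f (lo + i) ≡ 1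
  inside i i<hi-lo = cong₂ (λ b c → 𝟙 (b ∧ c)) (dec-true (lo ≤? lo + i) (m≤m+n lo i))
    (dec-true (lo + i <? hi) (subst (lo + i <_) (m+[n∸m]≡n lo≤hi) (+-monoʳ-< lo i<hi-lo)))
  above : ∀ i → i < N ∸ hi → f (lo + (hi ∸ lo) + i) ≡ 0
  above i _ = trans (cong (λ c → 𝟙 ((lo ≤ᵇ lo + (hi ∸ lo) + i) ∧ c))
      (dec-false (lo + (hi ∸ lo) + i <? hi) (≤⇒≯ (subst (λ x → hi ≤ x + i) (sym (m+[n∸m]≡n lo≤hi)) (m≤m+n hi i)))))
    (cong 𝟙 (∧-zeroʳ _))

∑-blocks : ∀ (h : ℕ → ℕ) (Z : ℕ → ℕ) k → Z 0 ≡ 0 → (∀ j → j < k → Z j ≤ Z (suc j)) →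
  ∑ (Z k) h ≡ ∑[ j < k ] ∑[ i < Z (suc j) ∸ Z j ] h (Z j + i)
∑-blocks h Z zero Z0≡0 _ = cong (λ l → ∑ l h) Z0≡0
∑-blocks h Z (suc k) Z0≡0 Z-mono = begin
  ∑ (Z (suc k)) h
    ≡⟨ cong (λ l → ∑ l h) (m+[n∸m]≡n (Z-mono k ≤-refl)) ⟨
  ∑ (Z k + (Z (suc k) ∸ Z k)) h
    ≡⟨ ∑-split h (Z k) (Z (suc k) ∸ Z k) ⟩
  ∑ (Z k) h + block k
    ≡⟨ cong (_+ block k) (∑-blocks h Z k Z0≡0 (λ j j<k → Z-mono j (<-trans j<k (n<1+n k)))) ⟩
  ∑ k block + block k
    ≡⟨ ∑-snoc block k ⟨
  ∑ (suc k) block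
    ∎
  where
  open ≡-Reasoning
  block : ℕ → ℕ
  block j = ∑[ i < Z (suc j) ∸ Z j ] h (Z j + i)

private
  𝟙-interval-split : ∀ α β γ x → α ≤ β → β ≤ γ →
    𝟙 ((β <ᵇ x) ∧ (x ≤ᵇ γ)) + 𝟙 ((α <ᵇ x) ∧ (x ≤ᵇ β)) ≡ 𝟙 ((α <ᵇ x) ∧ (x ≤ᵇ γ))
  𝟙-interval-split α β γ x α≤β β≤γ with x ≤? β
  ... | yes x≤β
    rewrite dec-false (β <? x) (≤⇒≯ x≤β) | dec-true (x ≤? β) x≤β | dec-true (x ≤? γ) (≤-trans x≤β β≤γ) = refl
  ... | no x≰β
    rewrite dec-true (β <? x) (≰⇒> x≰β) | dec-false (x ≤? β) x≰β | dec-true (α <? x) (≤-<-trans α≤β (≰⇒> x≰β)) =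
    +-identityʳ _

  𝟙-empty-interval : ∀ a x → 𝟙 ((a <ᵇ x) ∧ (x ≤ᵇ a)) ≡ 0
  𝟙-empty-interval a x with a <ᵇ x in a<ᵇx
  ... | true rewrite dec-false (x ≤? a) (<⇒≱ (does≡true⇒ (a <? x) a<ᵇx)) = refl
  ... | false = refl

∑-consecutive-intervals : ∀ n x h k → k ≤ h →
  ∑[ i < k ] 𝟙 (((h ∸ suc i) * n <ᵇ x) ∧ (x ≤ᵇ suc (h ∸ suc i) * n)) ≡ 𝟙 (((h ∸ k) * n <ᵇ x) ∧ (x ≤ᵇ h * n))
∑-consecutive-intervals n x h zero _ = sym (𝟙-empty-interval (h * n) x)
∑-consecutive-intervals n x h (suc k) k<h = begin
  ∑ (suc k) interval
    ≡⟨ ∑-snoc interval k ⟩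
  ∑ k interval + interval k
    ≡⟨ cong₂ _+_ (∑-consecutive-intervals n x h k (<⇒≤ k<h))
                 (cong (λ z → 𝟙 (((h ∸ suc k) * n <ᵇ x) ∧ (x ≤ᵇ z * n))) (sym (+-∸-assoc 1 k<h))) ⟩
  𝟙 (((h ∸ k) * n <ᵇ x) ∧ (x ≤ᵇ h * n)) + 𝟙 (((h ∸ suc k) * n <ᵇ x) ∧ (x ≤ᵇ (h ∸ k) * n))
    ≡⟨ 𝟙-interval-split ((h ∸ suc k) * n) ((h ∸ k) * n) (h * n) x
         (*-monoˡ-≤ n (∸-monoʳ-≤ h (n≤1+n k))) (*-monoˡ-≤ n (m∸n≤m h k)) ⟩
  𝟙 (((h ∸ suc k) * n <ᵇ x) ∧ (x ≤ᵇ h * n)) ∎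
  where
  open ≡-Reasoning
  interval : ℕ → ℕ
  interval i = 𝟙 (((h ∸ suc i) * n <ᵇ x) ∧ (x ≤ᵇ suc (h ∸ suc i) * n))

count-∷ : ∀ {A : Set} (p : A → Bool) x xs → count p (x ∷ xs) ≡ 𝟙 (p x) + count p xs
count-∷ p x xs with p x
... | true = refl
... | false = refl

count-++ : ∀ {A : Set} (p : A → Bool) xs ys → count p (xs ++ ys) ≡ count p xs + count p ys
count-++ p xs ys = trans (cong length (filter-++ (T? ∘ p) xs ys)) (length-++ (filterᵇ p xs))

count-map : ∀ {A B : Set} (p : B → Bool) (f : A → B) xs → count p (map f xs) ≡ count (p ∘ f) xs
count-map p f [] = refl
count-map p f (x ∷ xs) = trans (count-∷ p (f x) (map f xs))
  (trans (cong (_+_ (𝟙 (p (f x)))) (count-map p f xs)) (sym (count-∷ (p ∘ f) x xs)))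

count-concatMap : ∀ {A B : Set} (p : B → Bool) (f : A → List B) xs →
  count p (concatMap f xs) ≡ sum (map (count p ∘ f) xs)
count-concatMap p f [] = refl
count-concatMap p f (x ∷ xs) =
  trans (count-++ p (f x) (concatMap f xs)) (cong (_+_ (count p (f x))) (count-concatMap p f xs))

count-cong : ∀ {A : Set} {p q : A → Bool} xs → (∀ {x} → x ∈ xs → p x ≡ q x) → count p xs ≡ count q xs
count-cong {p = p} {q} [] _ = refl
count-cong {p = p} {q} (x ∷ xs) p≡q = begin
  count p (x ∷ xs)       ≡⟨ count-∷ p x xs ⟩
  𝟙 (p x) + count p xs   ≡⟨ cong₂ _+_ (cong 𝟙 (p≡q (here refl))) (count-cong xs (p≡q ∘ there)) ⟩
  𝟙 (q x) + count q xs   ≡⟨ count-∷ q x xs ⟨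
  count q (x ∷ xs)       ∎
  where open ≡-Reasoning

count-none : ∀ {A : Set} {p : A → Bool} xs → (∀ {x} → x ∈ xs → p x ≡ false) → count p xs ≡ 0
count-none [] _ = refl
count-none {p = p} (x ∷ xs) none =
  trans (count-∷ p x xs) (cong₂ _+_ (cong 𝟙 (none (here refl))) (count-none xs (none ∘ there)))

count-↭ : ∀ {A : Set} (p : A → Bool) {xs ys} → xs ↭ ys → count p xs ≡ count p ys
count-↭ p xs↭ys = ↭-length (filter-↭ (T? ∘ p) xs↭ys)

count≡sum-𝟙 : ∀ {A : Set} (p : A → Bool) xs → count p xs ≡ sum (map (𝟙 ∘ p) xs)
count≡sum-𝟙 p [] = refl
count≡sum-𝟙 p (x ∷ xs) = trans (count-∷ p x xs) (cong (_+_ (𝟙 (p x))) (count≡sum-𝟙 p xs))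

sum-map-range1 : ∀ (g : ℕ → ℕ) k → sum (map g (range1 k)) ≡ ∑[ i < k ] g (suc i)
sum-map-range1 g k = trans (cong (sum ∘ map g) (map-upTo suc k))
  (trans (cong sum (map-applyUpTo suc g k)) (go (g ∘ suc) k))
  where
  go : ∀ h k → sum (applyUpTo h k) ≡ ∑ k h
  go h zero = refl
  go h (suc k) = cong (_+_ (h 0)) (go (h ∘ suc) k)

count-range1 : ∀ (p : ℕ → Bool) k → count p (range1 k) ≡ ∑[ i < k ] 𝟙 (p (suc i))
count-range1 p k = trans (count≡sum-𝟙 p (range1 k)) (sum-map-range1 (𝟙 ∘ p) k)

count-cells : ∀ a n (p : ℕ × ℕ → Bool) →
  count p (cells a n) ≡ ∑[ j < n ] ∑[ i < a ] 𝟙 (p (suc i , suc j))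
count-cells a n p = begin
  count p (cells a n)
    ≡⟨ count-concatMap p _ (range1 a) ⟩
  sum (map (λ u → count p (map (u ,_) (range1 n))) (range1 a))
    ≡⟨ sum-map-range1 _ a ⟩
  ∑[ i < a ] count p (map (suc i ,_) (range1 n))
    ≡⟨ ∑-cong a (λ i _ → trans (count-map p (suc i ,_) (range1 n)) (count-range1 _ n)) ⟩
  ∑[ i < a ] ∑[ j < n ] 𝟙 (p (suc i , suc j))
    ≡⟨ ∑-comm (λ i j → 𝟙 (p (suc i , suc j))) a n ⟩
  ∑[ j < n ] ∑[ i < a ] 𝟙 (p (suc i , suc j))
    ∎
  where open ≡-Reasoning

private
  filterᵇ-concatMap : ∀ {A B : Set} (p : B → Bool) (f : A → List B) xs →
    filterᵇ p (concatMap f xs) ≡ concatMap (filterᵇ p ∘ f) xs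
  filterᵇ-concatMap p f [] = refl
  filterᵇ-concatMap p f (x ∷ xs) =
    trans (filter-++ (T? ∘ p) (f x) (concatMap f xs)) (cong (filterᵇ p (f x) ++_) (filterᵇ-concatMap p f xs))

  filterᵇ-map : ∀ {A B : Set} (p : B → Bool) (f : A → B) xs → filterᵇ p (map f xs) ≡ map f (filterᵇ (p ∘ f) xs)
  filterᵇ-map p f [] = refl
  filterᵇ-map p f (x ∷ xs) with p (f x)
  ... | true = cong (f x ∷_) (filterᵇ-map p f xs)
  ... | false = filterᵇ-map p f xs

  concatMap-if : ∀ {A B : Set} (b : A → Bool) (g : A → B) xs →
    concatMap (λ x → if b x then g x ∷ [] else []) xs ≡ map g (filterᵇ b xs)
  concatMap-if b g [] = refl
  concatMap-if b g (x ∷ xs) with b x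
  ... | true = cong (g x ∷_) (concatMap-if b g xs)
  ... | false = concatMap-if b g xs

  filterᵇ-cong : ∀ {A : Set} {p q : A → Bool} xs → (∀ {x} → x ∈ xs → p x ≡ q x) → filterᵇ p xs ≡ filterᵇ q xs
  filterᵇ-cong [] _ = refl
  filterᵇ-cong {p = p} {q} (x ∷ xs) p≡q with p x | q x | p≡q (here refl)
  ... | true  | .true  | refl = cong (x ∷_) (filterᵇ-cong xs (p≡q ∘ there))
  ... | false | .false | refl = filterᵇ-cong xs (p≡q ∘ there)

-- Differences of natural numbers in ℤ

module _ (a b c d : ℕ) where

  private
    cancel : ∀ x y z → (+ x ℤ.- + y) ℤ.+ (+ y ℤ.+ + z) ≡ + (x + z)
    cancel x y z = trans (solve (+ x) (+ y) (+ z)) (sym (ℤₚ.pos-+ x z))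
      where
      solve : ∀ (A B D : ℤ) → (A ℤ.- B) ℤ.+ (B ℤ.+ D) ≡ A ℤ.+ D
      solve = ℤ-Solver.solve-∀

    shift : ℤ
    shift = + b ℤ.+ + d

    lhs+shift : (+ a ℤ.- + b) ℤ.+ shift ≡ + (a + d)
    lhs+shift = cancel a b d

    rhs+shift : (+ c ℤ.- + d) ℤ.+ shift ≡ + (c + b)
    rhs+shift = trans (cong (ℤ._+_ (+ c ℤ.- + d)) (ℤₚ.+-comm (+ b) (+ d))) (cancel c d b)

    unshift : ∀ x → (x ℤ.+ shift) ℤ.- shift ≡ x
    unshift x = solve x shift
      where
      solve : ∀ (X S : ℤ) → (X ℤ.+ S) ℤ.- S ≡ X
      solve = ℤ-Solver.solve-∀

  −≡−⇒ : + a ℤ.- + b ≡ + c ℤ.- + d → a + d ≡ c + b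
  −≡−⇒ eq = ℤₚ.+-injective (trans (sym lhs+shift) (trans (cong (ℤ._+ shift) eq) rhs+shift))

  −≡−⇐ : a + d ≡ c + b → + a ℤ.- + b ≡ + c ℤ.- + d
  −≡−⇐ eq = trans (sym (unshift _)) (trans (cong (ℤ._- shift) (trans lhs+shift (trans (cong +_ eq) (sym rhs+shift))))
    (unshift _))

  −<−⇔ : (+ a ℤ.- + b) ℤ.< (+ c ℤ.- + d) ⇔ a + d < c + b
  −<−⇔ = mk⇔ to from
    where
    to : (+ a ℤ.- + b) ℤ.< (+ c ℤ.- + d) → a + d < c + b
    to x<y = ℤₚ.drop‿+<+ (subst₂ ℤ._<_ lhs+shift rhs+shift (ℤₚ.+-monoˡ-< shift x<y))
    from : a + d < c + b → (+ a ℤ.- + b) ℤ.< (+ c ℤ.- + d)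
    from lt = subst₂ ℤ._<_ (unshift _) (unshift _)
      (ℤₚ.+-monoˡ-< (ℤ.- shift) (subst₂ ℤ._<_ (sym lhs+shift) (sym rhs+shift) (+<+ lt)))

−+≡+− : ∀ a b e → (+ a ℤ.- + b) ℤ.+ + e ≡ + (a + e) ℤ.- + b
−+≡+− a b e = trans (solve (+ a) (+ b) (+ e)) (cong (ℤ._- + b) (sym (ℤₚ.pos-+ a e)))
  where
  solve : ∀ (A B E : ℤ) → (A ℤ.- B) ℤ.+ E ≡ (A ℤ.+ E) ℤ.- B
  solve = ℤ-Solver.solve-∀

-- Lattice paths, Dyck paths and stretching

stretch : Path → Path
stretch [] = []
stretch (true ∷ r) = true ∷ false ∷ stretch r
stretch (false ∷ r) = false ∷ stretch r

unstretch : Path → Path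
unstretch [] = []
unstretch (true ∷ false ∷ r) = true ∷ unstretch r
unstretch (true ∷ r) = true ∷ unstretch r
unstretch (false ∷ r) = false ∷ unstretch r

isStretched : Path → Bool
isStretched [] = true
isStretched (true ∷ false ∷ r) = isStretched r
isStretched (true ∷ _) = false
isStretched (false ∷ r) = isStretched r

unstretch-stretch : ∀ r → unstretch (stretch r) ≡ r
unstretch-stretch [] = refl
unstretch-stretch (true ∷ r) = cong (true ∷_) (unstretch-stretch r)
unstretch-stretch (false ∷ r) = cong (false ∷_) (unstretch-stretch r)

stretch-unstretch : ∀ r → isStretched r ≡ true → stretch (unstretch r) ≡ r
stretch-unstretch [] _ = refl
stretch-unstretch (true ∷ false ∷ r) s = cong (λ r′ → true ∷ false ∷ r′) (stretch-unstretch r s)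
stretch-unstretch (false ∷ r) s = cong (false ∷_) (stretch-unstretch r s)

isStretched-stretch : ∀ r → isStretched (stretch r) ≡ true
isStretched-stretch [] = refl
isStretched-stretch (true ∷ r) = isStretched-stretch r
isStretched-stretch (false ∷ r) = isStretched-stretch r

stretch-injective : ∀ {r s} → stretch r ≡ stretch s → r ≡ s
stretch-injective {r} {s} eq = trans (sym (unstretch-stretch r)) (trans (cong unstretch eq) (unstretch-stretch s))

countFalse : List Bool → ℕ
countFalse [] = 0
countFalse (true ∷ bs) = countFalse bs
countFalse (false ∷ bs) = suc (countFalse bs)

length≡countTrue+countFalse : ∀ p → length p ≡ countTrue p + countFalse p
length≡countTrue+countFalse [] = refl
length≡countTrue+countFalse (true ∷ p) = cong suc (length≡countTrue+countFalse p)
length≡countTrue+countFalse (false ∷ p) =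
  trans (cong suc (length≡countTrue+countFalse p)) (sym (+-suc (countTrue p) (countFalse p)))

countTrue-stretch : ∀ r → countTrue (stretch r) ≡ countTrue r
countTrue-stretch [] = refl
countTrue-stretch (true ∷ r) = cong suc (countTrue-stretch r)
countTrue-stretch (false ∷ r) = countTrue-stretch r

countFalse-stretch : ∀ r → countFalse (stretch r) ≡ countFalse r + countTrue r
countFalse-stretch [] = refl
countFalse-stretch (true ∷ r) = trans (cong suc (countFalse-stretch r)) (sym (+-suc (countFalse r) (countTrue r)))
countFalse-stretch (false ∷ r) = cong suc (countFalse-stretch r)

length-stretch : ∀ r → length (stretch r) ≡ length r + countTrue r
length-stretch r = begin
  length (stretch r)                                   ≡⟨ length≡countTrue+countFalse (stretch r) ⟩
  countTrue (stretch r) + countFalse (stretch r)       ≡⟨ cong₂ _+_ (countTrue-stretch r) (countFalse-stretch r) ⟩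
  countTrue r + (countFalse r + countTrue r)           ≡⟨ +-assoc (countTrue r) _ _ ⟨
  countTrue r + countFalse r + countTrue r             ≡⟨ cong (_+ countTrue r) (length≡countTrue+countFalse r) ⟨
  length r + countTrue r                               ∎
  where open ≡-Reasoning

-- Stretching moves the i-th north step i columns east.
addIndices : ℕ → List ℕ → List ℕ
addIndices k [] = []
addIndices k (x ∷ xs) = x + k ∷ addIndices (suc k) xs

northXsFrom-stretch : ∀ x k r → northXsFrom (x + k) (stretch r) ≡ addIndices k (northXsFrom x r)
northXsFrom-stretch x k [] = refl
northXsFrom-stretch x k (true ∷ r) =
  cong (x + k ∷_) (trans (cong (λ y → northXsFrom y (stretch r)) (sym (+-suc x k))) (northXsFrom-stretch x (suc k) r))
northXsFrom-stretch x k (false ∷ r) = northXsFrom-stretch (suc x) k r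

northXs-stretch : ∀ r → northXs (stretch r) ≡ addIndices 0 (northXs r)
northXs-stretch = northXsFrom-stretch 0 0

length-northXsFrom : ∀ x p → length (northXsFrom x p) ≡ countTrue p
length-northXsFrom x [] = refl
length-northXsFrom x (true ∷ p) = cong suc (length-northXsFrom x p)
length-northXsFrom x (false ∷ p) = length-northXsFrom (suc x) p

≤-head-northXsFrom : ∀ x p {z zs} → northXsFrom x p ≡ z ∷ zs → x ≤ z
≤-head-northXsFrom x (true ∷ p) refl = ≤-refl
≤-head-northXsFrom x (false ∷ p) eq = ≤-trans (n≤1+n x) (≤-head-northXsFrom (suc x) p eq)

northsAbove : ℕ → ℕ → ℕ → List ℕ → Bool
northsAbove a n y [] = true
northsAbove a n y (x ∷ xs) = (n * x ≤ᵇ a * y) ∧ northsAbove a n (suc y) xs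

-- Only the lattice points where a north step starts, and the endpoint, need checking:
-- a point followed by an east step is dominated by the next checked point.
aboveLineFrom≡ : ∀ a n x y p → aboveLineFrom a n x y p ≡
  (northsAbove a n y (northXsFrom x p) ∧ (n * (x + countFalse p) ≤ᵇ a * (y + countTrue p)))
aboveLineFrom≡ a n x y [] rewrite +-identityʳ x | +-identityʳ y = refl
aboveLineFrom≡ a n x y (true ∷ p) rewrite aboveLineFrom≡ a n x (suc y) p | +-suc y (countTrue p) =
  sym (∧-assoc (n * x ≤ᵇ a * y) _ _)
aboveLineFrom≡ a n x y (false ∷ p) rewrite aboveLineFrom≡ a n (suc x) y p | +-suc x (countFalse p) =
  b∧c≡c (λ rest → dec-true (n * x ≤? a * y) (≤-trans (*-monoʳ-≤ n (n≤1+n x)) (next-checked rest)))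
  where
  b∧c≡c : ∀ {b c} → (c ≡ true → b ≡ true) → (b ∧ c) ≡ c
  b∧c≡c {true} _ = refl
  b∧c≡c {false} {false} _ = refl
  b∧c≡c {false} {true} c⇒b = c⇒b refl
  next-checked : (northsAbove a n y (northXsFrom (suc x) p) ∧ (n * suc (x + countFalse p) ≤ᵇ a * (y + countTrue p))) ≡ true
    → n * suc x ≤ a * y
  next-checked rest with northXsFrom (suc x) p in eq
  ... | z ∷ zs = ≤-trans (*-monoʳ-≤ n (≤-head-northXsFrom (suc x) p eq))
      (does≡true⇒ (n * z ≤? a * y) (proj₁ (∧≡true⁻ (proj₁ (∧≡true⁻ rest)))))
  ... | [] = ≤-trans (*-monoʳ-≤ n (m≤m+n (suc x) (countFalse p)))
      (≤-trans (does≡true⇒ (_ ≤? _) (proj₂ (∧≡true⁻ rest))) (≤-reflexive (cong (λ c → a * c) y+0)))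
    where
    y+0 : y + countTrue p ≡ y
    y+0 = trans (cong (_+_ y) (trans (sym (length-northXsFrom (suc x) p)) (cong length eq))) (+-identityʳ y)

record IsDyck (a n : ℕ) (p : Path) : Set where
  field
    length≡ : length p ≡ a + n
    norths≡ : countTrue p ≡ n
    above : northsAbove a n 0 (northXs p) ≡ true

  easts≡ : countFalse p ≡ a
  easts≡ = +-cancelʳ-≡ n (countFalse p) a (begin
    countFalse p + n             ≡⟨ +-comm (countFalse p) n ⟩
    n + countFalse p             ≡⟨ cong (_+ countFalse p) norths≡ ⟨
    countTrue p + countFalse p   ≡⟨ length≡countTrue+countFalse p ⟨
    length p                     ≡⟨ length≡ ⟩
    a + n                        ∎)
    where open ≡-Reasoning

isDyck⇒IsDyck : ∀ a n p → isDyck a n p ≡ true → IsDyck a n p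
isDyck⇒IsDyck a n p h with ∧≡true⁻ h
... | len , h′ with ∧≡true⁻ h′
... | cnt , chk = record
  { length≡ = ≡ᵇ⇒≡ _ _ (Equivalence.from T-≡ len)
  ; norths≡ = ≡ᵇ⇒≡ _ _ (Equivalence.from T-≡ cnt)
  ; above = proj₁ (∧≡true⁻ (trans (sym (aboveLineFrom≡ a n 0 0 p)) chk))
  }

IsDyck⇒isDyck : ∀ a n p → IsDyck a n p → isDyck a n p ≡ true
IsDyck⇒isDyck a n p d = cong₂ _∧_ (≡ᵇ≡true length≡) (cong₂ _∧_ (≡ᵇ≡true norths≡)
  (trans (aboveLineFrom≡ a n 0 0 p) (cong₂ _∧_ above (dec-true (_ ≤? _) endpoint))))
  where
  open IsDyck d
  ≡ᵇ≡true : ∀ {i j} → i ≡ j → (i ≡ᵇ j) ≡ true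
  ≡ᵇ≡true {i} {j} i≡j = Equivalence.to T-≡ (≡⇒≡ᵇ i j i≡j)
  endpoint : n * (0 + countFalse p) ≤ a * (0 + countTrue p)
  endpoint rewrite easts≡ | norths≡ = ≤-reflexive (*-comm n a)

northsAbove-addIndices : ∀ m n y xs → n ≤ m → northsAbove m n y (addIndices y xs) ≡ northsAbove (m ∸ n) n y xs
northsAbove-addIndices m n y [] _ = refl
northsAbove-addIndices m n y (x ∷ xs) n≤m =
  cong₂ _∧_ (does-⇔ (mk⇔ cancel shift) (_ ≤? _) (_ ≤? _)) (northsAbove-addIndices m n (suc y) xs n≤m)
  where
  m*y≡ : m * y ≡ (m ∸ n) * y + n * y
  m*y≡ = trans (cong (_* y) (sym (m∸n+n≡m n≤m))) (*-distribʳ-+ y (m ∸ n) n)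
  cancel : n * (x + y) ≤ m * y → n * x ≤ (m ∸ n) * y
  cancel h = +-cancelʳ-≤ (n * y) (n * x) ((m ∸ n) * y)
    (≤-trans (≤-reflexive (sym (*-distribˡ-+ n x y))) (≤-trans h (≤-reflexive m*y≡)))
  shift : n * x ≤ (m ∸ n) * y → n * (x + y) ≤ m * y
  shift h = ≤-trans (≤-reflexive (*-distribˡ-+ n x y))
    (≤-trans (+-monoˡ-≤ (n * y) h) (≤-reflexive (sym m*y≡)))

IsDyck-stretch : ∀ m n q → n ≤ m → IsDyck (m ∸ n) n q → IsDyck m n (stretch q)
IsDyck-stretch m n q n≤m d = record
  { length≡ = trans (length-stretch q) (trans (cong₂ _+_ length≡ norths≡) (cong (_+ n) (m∸n+n≡m n≤m)))
  ; norths≡ = trans (countTrue-stretch q) norths≡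
  ; above = trans (cong (northsAbove m n 0) (northXs-stretch q))
      (trans (northsAbove-addIndices m n 0 (northXs q) n≤m) above)
  }
  where open IsDyck d

IsDyck-unstretch : ∀ m n p → n ≤ m → isStretched p ≡ true → IsDyck m n p → IsDyck (m ∸ n) n (unstretch p)
IsDyck-unstretch m n p n≤m s d = record
  { length≡ = +-cancelʳ-≡ n _ _ (begin
      length q + n                ≡⟨ cong (_+_ (length q)) norths≡q ⟨
      length q + countTrue q      ≡⟨ length-stretch q ⟨
      length (stretch q)          ≡⟨ cong length p≡ ⟩
      length p                    ≡⟨ length≡ ⟩
      m + n                       ≡⟨ cong (_+ n) (m∸n+n≡m n≤m) ⟨
      m ∸ n + n + n               ∎)
  ; norths≡ = norths≡q
  ; above = trans (sym (northsAbove-addIndices m n 0 (northXs q) n≤m))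
      (trans (cong (northsAbove m n 0) (sym (northXs-stretch q))) (trans (cong (northsAbove m n 0 ∘ northXs) p≡) above))
  }
  where
  open IsDyck d
  open ≡-Reasoning
  q = unstretch p
  p≡ : stretch q ≡ p
  p≡ = stretch-unstretch p s
  norths≡q : countTrue q ≡ n
  norths≡q = trans (sym (countTrue-stretch q)) (trans (cong countTrue p≡) norths≡)

northX : Path → ℕ → ℕ
northX p = at (northXs p)

at-addIndices : ∀ k xs i → suc i ≤ length xs → at (addIndices k xs) (suc i) ≡ at xs (suc i) + (i + k)
at-addIndices k (x ∷ xs) zero _ = refl
at-addIndices k (x ∷ xs) (suc i) (s≤s i<) = trans (at-addIndices (suc k) xs i i<) (cong (_+_ (at xs (suc i))) (+-suc i k))

northX-stretch : ∀ q i → i < countTrue q → northX (stretch q) (suc i) ≡ northX q (suc i) + i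
northX-stretch q i i< = begin
  at (northXs (stretch q)) (suc i)          ≡⟨ cong (λ xs → at xs (suc i)) (northXs-stretch q) ⟩
  at (addIndices 0 (northXs q)) (suc i)     ≡⟨ at-addIndices 0 (northXs q) i (subst (i <_) (sym (length-northXsFrom 0 q)) i<) ⟩
  northX q (suc i) + (i + 0)                ≡⟨ cong (_+_ (northX q (suc i))) (+-identityʳ i) ⟩
  northX q (suc i) + i                      ∎
  where open ≡-Reasoning

≤-at-northXsFrom : ∀ x r i → i < countTrue r → x ≤ at (northXsFrom x r) (suc i)
≤-at-northXsFrom x (true ∷ r) zero _ = ≤-refl
≤-at-northXsFrom x (true ∷ r) (suc i) (s≤s i<) = ≤-at-northXsFrom x r i i<
≤-at-northXsFrom x (false ∷ r) i i< = ≤-trans (n≤1+n x) (≤-at-northXsFrom (suc x) r i i<)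

at-northXsFrom-suc : ∀ x r i → suc i < countTrue r → at (northXsFrom x r) (suc i) ≤ at (northXsFrom x r) (suc (suc i))
at-northXsFrom-suc x (true ∷ r) zero (s≤s i<) = ≤-at-northXsFrom x r 0 i<
at-northXsFrom-suc x (true ∷ r) (suc i) (s≤s i<) = at-northXsFrom-suc x r i i<
at-northXsFrom-suc x (false ∷ r) i i< = at-northXsFrom-suc (suc x) r i i<

northsAbove-at : ∀ a n y xs → northsAbove a n y xs ≡ true → ∀ i → i < length xs → n * at xs (suc i) ≤ a * (y + i)
northsAbove-at a n y (x ∷ xs) above zero _ =
  subst (λ z → n * x ≤ a * z) (sym (+-identityʳ y)) (does≡true⇒ (_ ≤? _) (proj₁ (∧≡true⁻ above)))
northsAbove-at a n y (x ∷ xs) above (suc i) (s≤s i<) =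
  subst (λ z → n * at xs (suc i) ≤ a * z) (sym (+-suc y i))
    (northsAbove-at a n (suc y) xs (proj₂ (∧≡true⁻ {n * x ≤ᵇ a * y} above)) i i<)

not-stretched : ∀ x r → isStretched r ≡ false →
  (∃ λ i → suc i < countTrue r × at (northXsFrom x r) (suc i) ≡ at (northXsFrom x r) (suc (suc i)))
  ⊎ (∃ λ k → countTrue r ≡ suc k × at (northXsFrom x r) (suc k) ≡ x + countFalse r)
not-stretched x (true ∷ true ∷ r) _ = inj₁ (0 , s≤s (s≤s z≤n) , refl)
not-stretched x (true ∷ []) _ = inj₂ (0 , refl , sym (+-identityʳ x))
not-stretched x (true ∷ false ∷ r) s with not-stretched (suc x) r s
... | inj₁ (i , i< , eq) = inj₁ (suc i , s≤s i< , eq)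
... | inj₂ (k , len , eq) = inj₂ (suc k , cong suc len , trans eq (sym (+-suc x (countFalse r))))
not-stretched x (false ∷ r) s with not-stretched (suc x) r s
... | inj₁ (i , i< , eq) = inj₁ (i , i< , eq)
... | inj₂ (k , len , eq) = inj₂ (k , len , trans eq (sym (+-suc x (countFalse r))))

module IsDyckRows {a n p} (d : IsDyck a n p) where

  open IsDyck d

  length-northXs : length (northXs p) ≡ n
  length-northXs = trans (length-northXsFrom 0 p) norths≡

  northX-below : ∀ i → i < n → n * northX p (suc i) ≤ a * i
  northX-below i i<n = northsAbove-at a n 0 (northXs p) above i (subst (i <_) (sym length-northXs) i<n)

  northX-first : 0 < n → northX p 1 ≡ 0
  northX-first 0<n = n≤0⇒n≡0 (*-cancelˡ-≤ n (subst (n * northX p 1 ≤_) (sym (*-zeroʳ n))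
    (≤-trans (northX-below 0 0<n) (≤-reflexive (*-zeroʳ a)))))
    where instance _ = >-nonZero 0<n

  northX-< : 0 < a → ∀ i → i < n → northX p (suc i) < a
  northX-< 0<a i i<n = *-cancelˡ-< n _ _ (≤-<-trans (northX-below i i<n)
    (subst (a * i <_) (*-comm a n) (*-monoʳ-< a i<n)))
    where instance _ = >-nonZero 0<a

  northX-mono : ∀ i j → i ≤ j → j < n → northX p (suc i) ≤ northX p (suc j)
  northX-mono i j i≤j j<n with e , refl ← m≤n⇒∃[o]m+o≡n i≤j = go e j<n
    where
    go : ∀ e → i + e < n → northX p (suc i) ≤ northX p (suc (i + e))
    go zero _ = ≤-reflexive (cong (northX p ∘ suc) (sym (+-identityʳ i)))
    go (suc e) i+e+1<n = ≤-trans (go e (<-trans (≤-reflexive (sym (+-suc i e))) i+e+1<n))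
      (subst (λ z → northX p (suc (i + e)) ≤ northX p (suc z)) (sym (+-suc i e))
        (at-northXsFrom-suc 0 p (i + e) (subst (suc (i + e) <_) (sym norths≡) (subst (_< n) (+-suc i e) i+e+1<n))))

private
  extend : Path → List Path
  extend p = (true ∷ p) ∷ (false ∷ p) ∷ []

∈-allPaths : ∀ p → p ∈ allPaths (length p)
∈-allPaths [] = here refl
∈-allPaths (b ∷ p) = ∈-concatMap⁺ extend (Any.map (λ { refl → b∷p∈ b }) (∈-allPaths p))
  where
  b∷p∈ : ∀ b → (b ∷ p) ∈ extend p
  b∷p∈ true = here refl
  b∷p∈ false = there (here refl)

allPaths-length : ∀ k {p} → p ∈ allPaths k → length p ≡ k
allPaths-length zero (here refl) = refl
allPaths-length (suc k) p∈ with find (∈-concatMap⁻ extend {xs = allPaths k} p∈)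
... | _ , p′∈ , here refl = cong suc (allPaths-length k p′∈)
... | _ , p′∈ , there (here refl) = cong suc (allPaths-length k p′∈)

allPaths-unique : ∀ k → Unique (allPaths k)
allPaths-unique zero = [] ∷ []
allPaths-unique (suc k) = concatMap-extend-unique (allPaths-unique k)
  where
  tail-≡ : ∀ {v x y} → v ∈ extend x → v ∈ extend y → x ≡ y
  tail-≡ (here refl) (here refl) = refl
  tail-≡ (here refl) (there (here ()))
  tail-≡ (there (here refl)) (here ())
  tail-≡ (there (here refl)) (there (here refl)) = refl
  concatMap-extend-unique : ∀ {xs} → Unique xs → Unique (concatMap extend xs)
  concatMap-extend-unique [] = []
  concatMap-extend-unique {x ∷ xs} (x∉xs ∷ u) =
    Unique.++⁺ (((λ ()) ∷ []) ∷ [] ∷ []) (concatMap-extend-unique u) disjoint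
    where
    disjoint : ∀ {v} → ¬ (v ∈ extend x × v ∈ concatMap extend xs)
    disjoint (v∈ , v∈′) with find (∈-concatMap⁻ extend {xs = xs} v∈′)
    ... | y , y∈ , v∈″ = All¬⇒¬Any x∉xs (subst (_∈ xs) (sym (tail-≡ v∈ v∈″)) y∈)

∈-dyckPaths⁻ : ∀ a n {p} → p ∈ dyckPaths a n → IsDyck a n p
∈-dyckPaths⁻ a n {p} p∈ =
  isDyck⇒IsDyck a n p (Equivalence.to T-≡ (proj₂ (∈-filter⁻ (T? ∘ isDyck a n) {xs = allPaths (a + n)} p∈)))

∈-dyckPaths⁺ : ∀ a n {p} → IsDyck a n p → p ∈ dyckPaths a n
∈-dyckPaths⁺ a n {p} d = ∈-filter⁺ (T? ∘ isDyck a n)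
  (subst (λ k → p ∈ allPaths k) (IsDyck.length≡ d) (∈-allPaths p)) (Equivalence.from T-≡ (IsDyck⇒isDyck a n p d))

dyckPaths-unique : ∀ a n → Unique (dyckPaths a n)
dyckPaths-unique a n = Unique.filter⁺ (T? ∘ isDyck a n) (allPaths-unique (a + n))

stretched-dyckPaths : ∀ m n → n ≤ m → filterᵇ isStretched (dyckPaths m n) ↭ map stretch (dyckPaths (m ∸ n) n)
stretched-dyckPaths m n n≤m = ∼bag⇒↭ (unique∧set⇒bag
  (Unique.filter⁺ (T? ∘ isStretched) (dyckPaths-unique m n))
  (Unique.map⁺ stretch-injective (dyckPaths-unique (m ∸ n) n))
  (mk⇔ to from))
  where
  to : ∀ {p} → p ∈ filterᵇ isStretched (dyckPaths m n) → p ∈ map stretch (dyckPaths (m ∸ n) n)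
  to {p} p∈ with ∈-filter⁻ (T? ∘ isStretched) {xs = dyckPaths m n} p∈
  ... | p∈dyck , s = subst (_∈ map stretch (dyckPaths (m ∸ n) n)) (stretch-unstretch p s′)
      (∈-map⁺ stretch (∈-dyckPaths⁺ (m ∸ n) n (IsDyck-unstretch m n p n≤m s′ (∈-dyckPaths⁻ m n p∈dyck))))
    where s′ = Equivalence.to T-≡ s
  from : ∀ {p} → p ∈ map stretch (dyckPaths (m ∸ n) n) → p ∈ filterᵇ isStretched (dyckPaths m n)
  from p∈ with ∈-map⁻ stretch p∈
  ... | q , q∈ , refl = ∈-filter⁺ (T? ∘ isStretched)
      (∈-dyckPaths⁺ m n (IsDyck-stretch m n q n≤m (∈-dyckPaths⁻ (m ∸ n) n q∈)))
      (Equivalence.from T-≡ (isStretched-stretch q))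

-- Decreasing words and parking functions

isDecreasing : List ℤ → Bool
isDecreasing [] = true
isDecreasing (x ∷ []) = true
isDecreasing (x ∷ y ∷ w) = does (y ℤ.<? x) ∧ isDecreasing (y ∷ w)

headBelow : ℤ → List ℤ → Bool
headBelow x [] = true
headBelow x (y ∷ _) = does (y ℤ.<? x)

isDecreasing-∷ : ∀ x w → isDecreasing (x ∷ w) ≡ headBelow x w ∧ isDecreasing w
isDecreasing-∷ x [] = refl
isDecreasing-∷ x (y ∷ w) = refl

isDecreasing-tail : ∀ x w → isDecreasing (x ∷ w) ≡ true → isDecreasing w ≡ true
isDecreasing-tail x w dec = proj₂ (∧≡true⁻ (trans (sym (isDecreasing-∷ x w)) dec))

isDecreasing⇒<-head : ∀ x w → isDecreasing (x ∷ w) ≡ true → ∀ {z} → z ∈ w → z ℤ.< x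
isDecreasing⇒<-head x (y ∷ w) dec z∈ with ∧≡true⁻ {does (y ℤ.<? x)} dec
... | y<x , dec′ with z∈
...   | here refl = does≡true⇒ (y ℤ.<? x) y<x
...   | there z∈w = ℤₚ.<-trans (isDecreasing⇒<-head y w dec′ z∈w) (does≡true⇒ (y ℤ.<? x) y<x)

insertAll-↭ : ∀ {A : Set} (x : A) l {w} → w ∈ insertAll x l → w ↭ x ∷ l
insertAll-↭ x [] (here refl) = ↭-refl
insertAll-↭ x (y ∷ ys) (here refl) = ↭-refl
insertAll-↭ x (y ∷ ys) (there w∈) with ∈-map⁻ (y ∷_) w∈
... | w′ , w′∈ , refl = ↭-trans (prep y (insertAll-↭ x ys w′∈)) (swap y x ↭-refl)

perms-↭ : ∀ {A : Set} (R : List A) {w} → w ∈ perms R → w ↭ R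
perms-↭ [] (here refl) = ↭-refl
perms-↭ (x ∷ xs) w∈ with find (∈-concatMap⁻ (insertAll x) {xs = perms xs} w∈)
... | l , l∈ , w∈′ = ↭-trans (insertAll-↭ x l w∈′) (prep x (perms-↭ xs l∈))

count-decreasing-insertAll : ∀ x l → isDecreasing l ≡ true → x ∉ l → count isDecreasing (insertAll x l) ≡ 1
count-decreasing-insertAll x [] _ _ = refl
count-decreasing-insertAll x (y ∷ ys) dec x∉ with ℤₚ.<-cmp y x
... | tri< y<x _ _ = begin
  count isDecreasing (insertAll x (y ∷ ys))
    ≡⟨ count-∷ isDecreasing (x ∷ y ∷ ys) _ ⟩
  𝟙 (does (y ℤ.<? x) ∧ isDecreasing (y ∷ ys)) + count isDecreasing (map (y ∷_) (insertAll x ys))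
    ≡⟨ cong₂ _+_ (cong 𝟙 (cong₂ _∧_ (dec-true (y ℤ.<? x) y<x) dec))
         (trans (count-map isDecreasing (y ∷_) (insertAll x ys)) (count-none (insertAll x ys) later-fails)) ⟩
  1 ∎
  where
  open ≡-Reasoning
  later-fails : ∀ {w} → w ∈ insertAll x ys → isDecreasing (y ∷ w) ≡ false
  later-fails {w} w∈ with isDecreasing (y ∷ w) in dec′
  ... | false = refl
  ... | true = ⊥-elim (ℤₚ.<-asym y<x (isDecreasing⇒<-head y w dec′ (∈-resp-↭ (↭-sym (insertAll-↭ x ys w∈)) (here refl))))
... | tri≈ _ refl _ = ⊥-elim (x∉ (here refl))
... | tri> _ _ x<y = begin
  count isDecreasing (insertAll x (y ∷ ys))
    ≡⟨ count-∷ isDecreasing (x ∷ y ∷ ys) _ ⟩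
  𝟙 (does (y ℤ.<? x) ∧ isDecreasing (y ∷ ys)) + count isDecreasing (map (y ∷_) (insertAll x ys))
    ≡⟨ cong₂ _+_ (cong (λ b → 𝟙 (b ∧ isDecreasing (y ∷ ys))) (dec-false (y ℤ.<? x) (ℤₚ.<-asym x<y)))
         (trans (count-map isDecreasing (y ∷_) (insertAll x ys)) (count-cong (insertAll x ys) head-fine)) ⟩
  count isDecreasing (insertAll x ys)
    ≡⟨ count-decreasing-insertAll x ys (isDecreasing-tail y ys dec) (x∉ ∘ there) ⟩
  1 ∎
  where
  open ≡-Reasoning
  head-fine : ∀ {w} → w ∈ insertAll x ys → isDecreasing (y ∷ w) ≡ isDecreasing w
  head-fine {[]} _ = refl
  head-fine {z ∷ w} w∈ =
    cong (_∧ isDecreasing (z ∷ w)) (dec-true (z ℤ.<? y) (z<y (∈-resp-↭ (insertAll-↭ x ys w∈) (here refl))))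
    where
    z<y : z ∈ x ∷ ys → z ℤ.< y
    z<y (here refl) = x<y
    z<y (there z∈ys) = isDecreasing⇒<-head y ys dec z∈ys

isDecreasing-insertAll⁻ : ∀ x l {w} → w ∈ insertAll x l → isDecreasing w ≡ true → isDecreasing l ≡ true
isDecreasing-insertAll⁻ x [] _ _ = refl
isDecreasing-insertAll⁻ x (y ∷ ys) (here refl) dec = isDecreasing-tail x (y ∷ ys) dec
isDecreasing-insertAll⁻ x (y ∷ ys) (there w∈) dec with ∈-map⁻ (y ∷_) w∈
... | w′ , w′∈ , refl = trans (isDecreasing-∷ y ys)
  (cong₂ _∧_ (head-below ys (λ z∈ys → ∈-resp-↭ (↭-sym (insertAll-↭ x ys w′∈)) (there z∈ys)))
             (isDecreasing-insertAll⁻ x ys w′∈ (isDecreasing-tail y w′ dec)))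
  where
  head-below : ∀ zs → (∀ {z} → z ∈ zs → z ∈ w′) → headBelow y zs ≡ true
  head-below [] _ = refl
  head-below (z ∷ _) ⊆w′ = dec-true (z ℤ.<? y) (isDecreasing⇒<-head y w′ dec (⊆w′ (here refl)))

count-decreasing-perms : ∀ R → Unique R → count isDecreasing (perms R) ≡ 1
count-decreasing-perms [] _ = refl
count-decreasing-perms (x ∷ xs) (x∉xs ∷ u) = begin
  count isDecreasing (concatMap (insertAll x) (perms xs))
    ≡⟨ count-concatMap isDecreasing (insertAll x) (perms xs) ⟩
  sum (map (count isDecreasing ∘ insertAll x) (perms xs))
    ≡⟨ sum-map-cong (perms xs) each ⟩
  sum (map (𝟙 ∘ isDecreasing) (perms xs))
    ≡⟨ count≡sum-𝟙 isDecreasing (perms xs) ⟨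
  count isDecreasing (perms xs)
    ≡⟨ count-decreasing-perms xs u ⟩
  1 ∎
  where
  open ≡-Reasoning
  sum-map-cong : ∀ {f g : List ℤ → ℕ} ls → (∀ {l} → l ∈ ls → f l ≡ g l) → sum (map f ls) ≡ sum (map g ls)
  sum-map-cong [] _ = refl
  sum-map-cong (l ∷ ls) f≡g = cong₂ _+_ (f≡g (here refl)) (sum-map-cong ls (f≡g ∘ there))
  each : ∀ {l} → l ∈ perms xs → count isDecreasing (insertAll x l) ≡ 𝟙 (isDecreasing l)
  each {l} l∈ with isDecreasing l in dec
  ... | true = count-decreasing-insertAll x l dec (All¬⇒¬Any x∉xs ∘ ∈-resp-↭ (perms-↭ xs l∈))
  ... | false = count-none (insertAll x l) fails
    where
    fails : ∀ {w} → w ∈ insertAll x l → isDecreasing w ≡ false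
    fails {w} w∈ with isDecreasing w in dec′
    ... | false = refl
    ... | true with () ← trans (sym dec) (isDecreasing-insertAll⁻ x l w∈ dec′)

desList≡fullSet⇔isDecreasing : ∀ W → does (≡-dec Bool._≟_ (desList W) (fullSet (length W))) ≡ isDecreasing W
desList≡fullSet⇔isDecreasing W with isDecreasing W in dec
... | true = dec-true (≡-dec Bool._≟_ _ _) (decreasing⇒ W dec)
  where
  decreasing⇒ : ∀ W → isDecreasing W ≡ true → desList W ≡ replicate (length W ∸ 1) true
  decreasing⇒ [] _ = refl
  decreasing⇒ (x ∷ []) _ = refl
  decreasing⇒ (x ∷ y ∷ w) dec = cong₂ _∷_ (proj₁ (∧≡true⁻ {does (y ℤ.<? x)} dec))
    (decreasing⇒ (y ∷ w) (proj₂ (∧≡true⁻ {does (y ℤ.<? x)} dec)))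
... | false = dec-false (≡-dec Bool._≟_ _ _) (λ des → case trans (sym dec) (⇒decreasing W des) of λ ())
  where
  ⇒decreasing : ∀ W → desList W ≡ replicate (length W ∸ 1) true → isDecreasing W ≡ true
  ⇒decreasing [] _ = refl
  ⇒decreasing (x ∷ []) _ = refl
  ⇒decreasing (x ∷ y ∷ w) des = cong₂ _∧_ (∷-injectiveˡ des) (⇒decreasing (y ∷ w) (∷-injectiveʳ des))

elemℤ-∈⁻ : ∀ k R → elemℤ k R ≡ true → k ∈ R
elemℤ-∈⁻ k (x ∷ R) h with k ℤ.≟ x
... | yes refl = here refl
... | no _ = there (elemℤ-∈⁻ k R h)

elemℤ-∈⁺ : ∀ {k} R → k ∈ R → elemℤ k R ≡ true
elemℤ-∈⁺ {k} (x ∷ R) (here refl) = cong (_∨ elemℤ k R) (dec-true (k ℤ.≟ k) refl)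
elemℤ-∈⁺ {k} (x ∷ R) (there k∈) with k ℤ.≟ x
... | yes _ = refl
... | no _ = elemℤ-∈⁺ R k∈

elemℤ-∉ : ∀ k R → k ∉ R → elemℤ k R ≡ false
elemℤ-∉ k R k∉ with elemℤ k R in e
... | false = refl
... | true = ⊥-elim (k∉ (elemℤ-∈⁻ k R e))

leftOf-decreasing : ∀ {k k′} w → isDecreasing w ≡ true → k ∈ w → k′ ∈ w → k ℤ.< k′ → leftOf k k′ w ≡ false
leftOf-decreasing {k} {k′} (z ∷ zs) dec k∈ k′∈ k<k′ with z ℤ.≟ k
... | yes refl = ⊥-elim (ℤₚ.<-asym k<k′ (isDecreasing⇒<-head z zs dec (Any.tail (ℤₚ.<⇒≢ k<k′ ∘ sym) k′∈)))
... | no z≢k with z ℤ.≟ k′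
...   | yes _ = refl
...   | no z≢k′ =
  leftOf-decreasing zs (isDecreasing-tail z zs dec) (Any.tail (z≢k ∘ sym) k∈) (Any.tail (z≢k′ ∘ sym) k′∈) k<k′

module _ (m : ℕ) (R W : List ℤ) where

  private
    admissible : List ℤ → Bool
    admissible = foldr (λ k b → (not (elemℤ (k ℤ.+ + m) R) ∨ leftOf k (k ℤ.+ + m) W) ∧ b) true

    admissible-separated : ∀ L → (∀ {k} → k ∈ L → (k ℤ.+ + m) ∉ R) → admissible L ≡ true
    admissible-separated [] _ = refl
    admissible-separated (k ∷ L) sep rewrite elemℤ-∉ (k ℤ.+ + m) R (sep (here refl)) =
      admissible-separated L (sep ∘ there)

    admissible-violated : ∀ L {k} → k ∈ L → elemℤ (k ℤ.+ + m) R ≡ true → leftOf k (k ℤ.+ + m) W ≡ false →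
      admissible L ≡ false
    admissible-violated (_ ∷ L) (here refl) k+m∈ notLeft rewrite k+m∈ | notLeft = refl
    admissible-violated (l ∷ L) (there k∈) k+m∈ notLeft rewrite admissible-violated L k∈ k+m∈ notLeft =
      ∧-zeroʳ _

  validWord-separated : (∀ {k} → k ∈ R → (k ℤ.+ + m) ∉ R) → validWord m R W ≡ true
  validWord-separated = admissible-separated R

  validWord-decreasing : ∀ {k} → 0 < m → W ↭ R → isDecreasing W ≡ true → k ∈ R → (k ℤ.+ + m) ∈ R →
    validWord m R W ≡ false
  validWord-decreasing {k} 0<m W↭R dec k∈ k+m∈ = admissible-violated R k∈ (elemℤ-∈⁺ R k+m∈)
    (leftOf-decreasing W dec (∈-resp-↭ (↭-sym W↭R) k∈) (∈-resp-↭ (↭-sym W↭R) k+m∈) k<k+m)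
    where
    k<k+m : k ℤ.< k ℤ.+ + m
    k<k+m = subst (ℤ._< k ℤ.+ + m) (ℤₚ.+-identityʳ k) (ℤₚ.+-monoʳ-< k (ℤ.+<+ 0<m))

isClose : ℕ → ℤ → ℤ → Bool
isClose m x y = does (x ℤ.<? y ℤ.+ + m) ∧ does (y ℤ.<? x ℤ.+ + m)

isClose-sym : ∀ m x y → isClose m x y ≡ isClose m y x
isClose-sym m x y = ∧-comm (does (x ℤ.<? y ℤ.+ + m)) _

closePairs : ℕ → List ℤ → ℕ
closePairs m [] = 0
closePairs m (x ∷ l) = count (isClose m x) l + closePairs m l

inv-decreasing : ∀ m W → isDecreasing W ≡ true → inv m W ≡ closePairs m W
inv-decreasing m [] _ = refl
inv-decreasing m (w ∷ ws) dec = cong₂ _+_ (count-cong ws below⇒close) (inv-decreasing m ws (isDecreasing-tail w ws dec))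
  where
  below⇒close : ∀ {w′} → w′ ∈ ws → (does (w′ ℤ.<? w) ∧ does (w ℤ.<? w′ ℤ.+ + m)) ≡ isClose m w w′
  below⇒close {w′} w′∈ = begin
    does (w′ ℤ.<? w) ∧ does (w ℤ.<? w′ ℤ.+ + m)   ≡⟨ cong (_∧ does (w ℤ.<? w′ ℤ.+ + m)) (dec-true (w′ ℤ.<? w) w′<w) ⟩
    does (w ℤ.<? w′ ℤ.+ + m)                       ≡⟨ ∧-identityʳ _ ⟨
    does (w ℤ.<? w′ ℤ.+ + m) ∧ true                ≡⟨ cong (does (w ℤ.<? w′ ℤ.+ + m) ∧_) w′<w+m ⟨
    isClose m w w′                                 ∎
    where
    open ≡-Reasoning
    w′<w = isDecreasing⇒<-head w ws dec w′∈
    w′<w+m = dec-true (w′ ℤ.<? w ℤ.+ + m) (ℤₚ.<-≤-trans w′<w (ℤₚ.i≤i+j w (+ m)))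

closePairs-↭ : ∀ m {xs ys} → xs ↭ ys → closePairs m xs ≡ closePairs m ys
closePairs-↭ m ↭-refl′ = refl
closePairs-↭ m (prep x xs↭ys) = cong₂ _+_ (count-↭ (isClose m x) xs↭ys) (closePairs-↭ m xs↭ys)
closePairs-↭ m {x ∷ y ∷ xs} {.y ∷ .x ∷ ys} (swap .x .y xs↭ys) = begin
  closePairs m (x ∷ y ∷ xs)
    ≡⟨ cong (_+ closePairs m (y ∷ xs)) (count-∷ (isClose m x) y xs) ⟩
  (𝟙 (isClose m x y) + count (isClose m x) xs) + (count (isClose m y) xs + closePairs m xs)
    ≡⟨ cong₂ _+_ (cong (_+_ (𝟙 (isClose m x y))) (count-↭ (isClose m x) xs↭ys))
                 (cong₂ _+_ (count-↭ (isClose m y) xs↭ys) (closePairs-↭ m xs↭ys)) ⟩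
  (𝟙 (isClose m x y) + count (isClose m x) ys) + (count (isClose m y) ys + closePairs m ys)
    ≡⟨ interchange (𝟙 (isClose m x y)) _ _ _ ⟩
  (𝟙 (isClose m x y) + count (isClose m y) ys) + (count (isClose m x) ys + closePairs m ys)
    ≡⟨ cong (λ b → (𝟙 b + count (isClose m y) ys) + (count (isClose m x) ys + closePairs m ys)) (isClose-sym m x y) ⟩
  (𝟙 (isClose m y x) + count (isClose m y) ys) + (count (isClose m x) ys + closePairs m ys)
    ≡⟨ cong (_+ closePairs m (x ∷ ys)) (count-∷ (isClose m y) x ys) ⟨
  closePairs m (y ∷ x ∷ ys)
    ∎
  where open ≡-Reasoning
closePairs-↭ m (↭-trans′ xs↭ys ys↭zs) = trans (closePairs-↭ m xs↭ys) (closePairs-↭ m ys↭zs)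

closePairs-∷ʳ : ∀ m l y → closePairs m (l ++ y ∷ []) ≡ closePairs m l + count (isClose m y) l
closePairs-∷ʳ m [] y = refl
closePairs-∷ʳ m (x ∷ l) y = begin
  count (isClose m x) (l ++ y ∷ []) + closePairs m (l ++ y ∷ [])
    ≡⟨ cong₂ _+_ (trans (count-++ (isClose m x) l (y ∷ []))
                        (cong (_+_ (count (isClose m x) l)) (trans (count-∷ (isClose m x) y []) (+-identityʳ _))))
                 (closePairs-∷ʳ m l y) ⟩
  (count (isClose m x) l + 𝟙 (isClose m x y)) + (closePairs m l + count (isClose m y) l)
    ≡⟨ interchange (count (isClose m x) l) _ _ _ ⟩
  closePairs m (x ∷ l) + (𝟙 (isClose m x y) + count (isClose m y) l)
    ≡⟨ cong (λ b → closePairs m (x ∷ l) + (𝟙 b + count (isClose m y) l)) (isClose-sym m x y) ⟩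
  closePairs m (x ∷ l) + (𝟙 (isClose m y x) + count (isClose m y) l)
    ≡⟨ cong (_+_ (closePairs m (x ∷ l))) (count-∷ (isClose m y) x l) ⟨
  closePairs m (x ∷ l) + count (isClose m y) (x ∷ l)
    ∎
  where open ≡-Reasoning

closePairs-range1 : ∀ m (r : ℕ → ℤ) n →
  closePairs m (map r (range1 n)) ≡ ∑[ k < n ] ∑[ i < k ] 𝟙 (isClose m (r (suc k)) (r (suc i)))
closePairs-range1 m r zero = refl
closePairs-range1 m r (suc n) = begin
  closePairs m (map r (range1 (suc n)))
    ≡⟨ cong (closePairs m) range1-∷ʳ ⟩
  closePairs m (map r (range1 n) ++ r (suc n) ∷ [])
    ≡⟨ closePairs-∷ʳ m (map r (range1 n)) (r (suc n)) ⟩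
  closePairs m (map r (range1 n)) + count (isClose m (r (suc n))) (map r (range1 n))
    ≡⟨ cong₂ _+_ (closePairs-range1 m r n) (trans (count-map (isClose m (r (suc n))) r (range1 n)) (count-range1 _ n)) ⟩
  ∑ n pairsBelow + pairsBelow n
    ≡⟨ ∑-snoc pairsBelow n ⟨
  ∑ (suc n) pairsBelow
    ∎
  where
  open ≡-Reasoning
  pairsBelow : ℕ → ℕ
  pairsBelow k = ∑[ i < k ] 𝟙 (isClose m (r (suc k)) (r (suc i)))
  range1-∷ʳ : map r (range1 (suc n)) ≡ map r (range1 n) ++ r (suc n) ∷ []
  range1-∷ʳ = trans (cong (map r ∘ map suc) (sym (upTo-∷ʳ n)))
    (trans (cong (map r) (map-++ suc (upTo n) (n ∷ []))) (map-++ r (range1 n) (suc n ∷ [])))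

hasFullDescentSet : ℕ → List ℤ → Bool
hasFullDescentSet n W = does (≡-dec Bool._≟_ (desList W) (fullSet n))

fullDescentWords : ℕ → ℕ → List ℤ → List (List ℤ)
fullDescentWords m n R = filterᵇ (hasFullDescentSet n) (filterᵇ (validWord m R) (perms R))

hasFullDescentSet≡isDecreasing : ∀ n R {W} → length R ≡ n → W ∈ perms R → hasFullDescentSet n W ≡ isDecreasing W
hasFullDescentSet≡isDecreasing n R {W} refl W∈ =
  subst (λ l → hasFullDescentSet l W ≡ isDecreasing W) (↭-length (perms-↭ R W∈)) (desList≡fullSet⇔isDecreasing W)

fullDescentWords-separated : ∀ m n R → length R ≡ n → Unique R → (∀ {k} → k ∈ R → (k ℤ.+ + m) ∉ R) →
  map (inv m) (fullDescentWords m n R) ≡ closePairs m R ∷ []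
fullDescentWords-separated m n R len≡ R-unique separated
  with filterᵇ isDecreasing (perms R) in decreasing≡ | count-decreasing-perms R R-unique
... | w ∷ [] | _ = begin
  map (inv m) (filterᵇ (hasFullDescentSet n) (filterᵇ (validWord m R) (perms R)))
    ≡⟨ cong (map (inv m) ∘ filterᵇ (hasFullDescentSet n)) all-valid ⟩
  map (inv m) (filterᵇ (hasFullDescentSet n) (perms R))
    ≡⟨ cong (map (inv m)) (filterᵇ-cong (perms R) (hasFullDescentSet≡isDecreasing n R len≡)) ⟩
  map (inv m) (filterᵇ isDecreasing (perms R))
    ≡⟨ cong (map (inv m)) decreasing≡ ⟩
  inv m w ∷ []
    ≡⟨ cong (_∷ []) (trans (inv-decreasing m w w-decreasing) (closePairs-↭ m (perms-↭ R w∈))) ⟩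
  closePairs m R ∷ [] ∎
  where
  open ≡-Reasoning
  all-valid : filterᵇ (validWord m R) (perms R) ≡ perms R
  all-valid = filter-all (T? ∘ validWord m R)
    (All.tabulate (λ {W} _ → Equivalence.from T-≡ (validWord-separated m R W separated)))
  w∈filter : w ∈ filterᵇ isDecreasing (perms R)
  w∈filter = subst (w ∈_) (sym decreasing≡) (here refl)
  w∈ = proj₁ (∈-filter⁻ (T? ∘ isDecreasing) {xs = perms R} w∈filter)
  w-decreasing = Equivalence.to T-≡ (proj₂ (∈-filter⁻ (T? ∘ isDecreasing) {xs = perms R} w∈filter))

fullDescentWords-unseparated : ∀ m n R {k} → length R ≡ n → 0 < m → k ∈ R → (k ℤ.+ + m) ∈ R →
  fullDescentWords m n R ≡ []
fullDescentWords-unseparated m n R len≡ 0<m k∈ k+m∈ =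
  filter-none (T? ∘ hasFullDescentSet n) (All.tabulate not-full)
  where
  not-full : ∀ {W} → W ∈ filterᵇ (validWord m R) (perms R) → ¬ T (hasFullDescentSet n W)
  not-full {W} W∈ full with ∈-filter⁻ (T? ∘ validWord m R) {xs = perms R} W∈
  ... | W∈perms , valid = subst T (validWord-decreasing m R W 0<m (perms-↭ R W∈perms) decreasing k∈ k+m∈) valid
    where
    decreasing : isDecreasing W ≡ true
    decreasing = trans (sym (hasFullDescentSet≡isDecreasing n R len≡ W∈perms)) (Equivalence.to T-≡ full)

-- Ranks

rank≡ : ∀ m n u v → v ≤ suc n → rank m n u v ≡ + (v * m) ℤ.- + (u * n + m)
rank≡ m n u v v≤ = begin
  (+ (m * n) ℤ.- + (u * n)) ℤ.- + t*m      ≡⟨ merge (+ (m * n)) (+ (u * n)) (+ t*m) ⟩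
  + (m * n) ℤ.- (+ (u * n) ℤ.+ + t*m)      ≡⟨ cong (λ z → + (m * n) ℤ.- z) (ℤₚ.pos-+ (u * n) t*m) ⟨
  + (m * n) ℤ.- + (u * n + t*m)            ≡⟨ −≡−⇐ (m * n) (u * n + t*m) (v * m) (u * n + m) balance ⟩
  + (v * m) ℤ.- + (u * n + m)              ∎
  where
  open ≡-Reasoning
  t*m = (suc n ∸ v) * m
  merge : ∀ (K U T : ℤ) → (K ℤ.- U) ℤ.- T ≡ K ℤ.- (U ℤ.+ T)
  merge = ℤ-Solver.solve-∀
  balance : m * n + (u * n + m) ≡ v * m + (u * n + t*m)
  balance = begin
    m * n + (u * n + m)            ≡⟨ e₁ m n u ⟩
    suc n * m + u * n              ≡⟨ cong (λ z → z * m + u * n) (m+[n∸m]≡n v≤) ⟨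
    (v + (suc n ∸ v)) * m + u * n  ≡⟨ e₂ v (suc n ∸ v) m u n ⟩
    v * m + (u * n + t*m)          ∎
    where
    e₁ : ∀ m n u → m * n + (u * n + m) ≡ suc n * m + u * n
    e₁ = ℕ-Solver.solve-∀
    e₂ : ∀ v t m u n → (v + t) * m + u * n ≡ v * m + (u * n + t * m)
    e₂ = ℕ-Solver.solve-∀

private
  coprime-gap≡0 : ∀ {n m} → Coprime n m → ∀ A B s e → A * n + s * m ≡ B * n + (s + e) * m → e < n → e ≡ 0
  coprime-gap≡0 cop A B s zero _ _ = refl
  coprime-gap≡0 {n} {m} cop A B s (suc e) eq e<n = ⊥-elim (<⇒≱ e<n (∣⇒≤ n∣1+e))
    where
    rearrange : ∀ B n s e m → B * n + (s + e) * m ≡ (B * n + e * m) + s * m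
    rearrange = ℕ-Solver.solve-∀
    An≡ : A * n ≡ B * n + suc e * m
    An≡ = +-cancelʳ-≡ (s * m) _ _ (trans eq (rearrange B n s (suc e) m))
    n∣1+e : n ∣ suc e
    n∣1+e = coprime-divisor cop (subst (n ∣_) (*-comm (suc e) m) (∣m+n∣m⇒∣n (subst (n ∣_) An≡ (n∣m*n A)) (n∣m*n B)))

-- From A n + s m = B n + t m, n divides (t − s) m, hence t − s; and |t − s| < n.
coprime-cancel : ∀ {n m} → Coprime n m → ∀ A B s t → A * n + s * m ≡ B * n + t * m → s < t + n → t < s + n → s ≡ t
coprime-cancel cop A B s t eq s<t+n t<s+n with ≤-total s t
... | inj₁ s≤t with e , refl ← m≤n⇒∃[o]m+o≡n s≤t =
  sym (trans (cong (_+_ s) (coprime-gap≡0 cop A B s e eq (+-cancelˡ-< s e _ t<s+n))) (+-identityʳ s))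
... | inj₂ t≤s with e , refl ← m≤n⇒∃[o]m+o≡n t≤s =
  trans (cong (_+_ t) (coprime-gap≡0 cop B A t e (sym eq) (+-cancelˡ-< t e _ s<t+n))) (+-identityʳ t)

isClose-− : ∀ m a b c d → isClose m (+ a ℤ.- + b) (+ c ℤ.- + d) ≡ ((a + d <ᵇ c + m + b) ∧ (c + b <ᵇ a + m + d))
isClose-− m a b c d = cong₂ _∧_ (below a b c d) (below c d a b)
  where
  below : ∀ a b c d → does ((+ a ℤ.- + b) ℤ.<? (+ c ℤ.- + d) ℤ.+ + m) ≡ (a + d <ᵇ c + m + b)
  below a b c d = trans (cong (λ z → does ((+ a ℤ.- + b) ℤ.<? z)) (−+≡+− c d m))
    (does-⇔ (−<−⇔ a b (c + m) d) ((+ a ℤ.- + b) ℤ.<? (+ (c + m) ℤ.- + d)) (_ <? _))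

module PathRanks (m n : ℕ) (0<n : 0 < n) (n<m : n < m) (cop : Coprime m n) where

  pathRank : Path → ℕ → ℤ
  pathRank p v = rank m n (suc (northX p v)) v

  pathRank≡ : ∀ p v → v ≤ suc n → pathRank p v ≡ + (v * m) ℤ.- + (suc (northX p v) * n + m)
  pathRank≡ p v = rank≡ m n (suc (northX p v)) v

  rankList≡ : ∀ p → rankList m n p ≡ applyUpTo (pathRank p ∘ suc) n
  rankList≡ p = trans (cong (map (pathRank p)) (map-upTo suc n)) (map-applyUpTo suc (pathRank p) n)

  length-rankList : ∀ p → length (rankList m n p) ≡ n
  length-rankList p = trans (cong length (rankList≡ p)) (length-applyUpTo _ n)

  ∈-rankList⁻ : ∀ p {k} → k ∈ rankList m n p → ∃ λ i → i < n × k ≡ pathRank p (suc i)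
  ∈-rankList⁻ p k∈ with ∈-map⁻ (pathRank p) k∈
  ... | v , v∈ , refl with ∈-map⁻ suc v∈
  ...   | i , i∈ , refl = i , ∈-upTo⁻ i∈ , refl

  ∈-rankList⁺ : ∀ p {i} → i < n → pathRank p (suc i) ∈ rankList m n p
  ∈-rankList⁺ p i<n = ∈-map⁺ (pathRank p) (∈-map⁺ suc (∈-upTo⁺ i<n))

  private
    row≤ : ∀ {i} → i < n → suc i ≤ suc n
    row≤ i<n = s≤s (<⇒≤ i<n)

    cancel-m : ∀ a b c d → a + (b + m) ≡ c + (d + m) → b + a ≡ d + c
    cancel-m a b c d eq = +-cancelʳ-≡ m _ _ (trans (rearrange b a) (trans eq (sym (rearrange d c))))
      where
      rearrange : ∀ x y → x + y + m ≡ y + (x + m)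
      rearrange x y = trans (+-assoc x y m) (trans (cong (_+_ x) (+-comm y m)) (trans (sym (+-assoc x m y)) (+-comm (x + m) y)))

  rankList-unique : ∀ p → Unique (rankList m n p)
  rankList-unique p = subst Unique (sym (rankList≡ p)) (Unique.applyUpTo⁺₁ (pathRank p ∘ suc) n distinct)
    where
    distinct : ∀ {i j} → i < j → j < n → pathRank p (suc i) ≢ pathRank p (suc j)
    distinct {i} {j} i<j j<n eq = <⇒≢ i<j (suc-injective (coprime-cancel (Coprimality.sym cop)
      (suc xⱼ) (suc xᵢ) (suc i) (suc j)
      (cancel-m (suc i * m) (suc xⱼ * n) (suc j * m) (suc xᵢ * n) (−≡−⇒ _ (suc xᵢ * n + m) _ (suc xⱼ * n + m)
        (trans (sym (pathRank≡ p (suc i) (row≤ (<-trans i<j j<n)))) (trans eq (pathRank≡ p (suc j) (row≤ j<n))))))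
      (s≤s (<-≤-trans i<j (m≤m+n j n))) (s≤s (<-≤-trans j<n (m≤n+m n i)))))
      where
      xᵢ = northX p (suc i)
      xⱼ = northX p (suc j)

  stretched-northX-< : ∀ p → IsDyck m n p → isStretched p ≡ true →
    ∀ i → suc i < n → northX p (suc i) < northX p (suc (suc i))
  stretched-northX-< p d s i i+1<n = subst₂ _<_ (sym (xₚ≡ i (<-trans (n<1+n i) i+1<n))) (sym (xₚ≡ (suc i) i+1<n))
    (+-mono-≤-< (IsDyckRows.northX-mono d′ i (suc i) (n≤1+n i) i+1<n) (n<1+n i))
    where
    q = unstretch p
    d′ : IsDyck (m ∸ n) n q
    d′ = IsDyck-unstretch m n p (<⇒≤ n<m) s d
    xₚ≡ : ∀ j → j < n → northX p (suc j) ≡ northX q (suc j) + j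
    xₚ≡ j j<n = trans (cong (λ r → northX r (suc j)) (sym (stretch-unstretch p s)))
      (northX-stretch q j (subst (j <_) (sym (IsDyck.norths≡ d′)) j<n))

  private
    instance
      n≢0 : NonZero n
      n≢0 = >-nonZero 0<n

    rank+m≡rank : ∀ p {i j} → i < n → j < n → pathRank p (suc j) ℤ.+ + m ≡ pathRank p (suc i) →
      suc (northX p (suc i)) * n + suc (suc j) * m ≡ suc (northX p (suc j)) * n + suc i * m
    rank+m≡rank p {i} {j} i<n j<n eq = trans (cong (_+_ (suc xᵢ * n)) (+-comm m (suc j * m)))
      (cancel-m (suc j * m + m) (suc xᵢ * n) (suc i * m) (suc xⱼ * n) (−≡−⇒ _ (suc xⱼ * n + m) _ (suc xᵢ * n + m)
        (trans (sym (−+≡+− (suc j * m) (suc xⱼ * n + m) m))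
          (trans (cong (ℤ._+ + m) (sym (pathRank≡ p (suc j) (row≤ j<n)))) (trans eq (pathRank≡ p (suc i) (row≤ i<n)))))))
      where
      xᵢ = northX p (suc i)
      xⱼ = northX p (suc j)

  rank-separated : ∀ p → IsDyck m n p → isStretched p ≡ true →
    ∀ {k} → k ∈ rankList m n p → (k ℤ.+ + m) ∉ rankList m n p
  rank-separated p d s k∈ k+m∈ with ∈-rankList⁻ p k∈ | ∈-rankList⁻ p k+m∈
  ... | j , j<n , refl | i , i<n , eq with rank+m≡rank p i<n j<n eq | suc (suc j) <? suc i + n
  ...   | lin | yes j+2<i+1+n
    with coprime-cancel (Coprimality.sym cop) (suc (northX p (suc i))) (suc (northX p (suc j))) _ _ lin
           j+2<i+1+n (s≤s (<-≤-trans i<n (m≤n+m n (suc j))))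
  ...     | refl = <⇒≢ (stretched-northX-< p d s j i<n)
                (sym (suc-injective (*-cancelʳ-≡ _ _ n (+-cancelʳ-≡ (suc i * m) _ _ lin))))
  rank-separated p d s k∈ k+m∈ | j , j<n , refl | i , i<n , eq | lin | no far =
    <⇒≢ (IsDyckRows.northX-< d (<-trans 0<n n<m) j j<n) xⱼ≡m
    where
    open IsDyckRows d
    i+n≤j+1 : i + n ≤ suc j
    i+n≤j+1 = ≤-pred (≮⇒≥ far)
    i≡0 : i ≡ 0
    i≡0 = n≤0⇒n≡0 (+-cancelʳ-≤ n i 0 (≤-trans i+n≤j+1 j<n))
    j+1≡n : suc j ≡ n
    j+1≡n = ≤-antisym j<n (≤-trans (m≤n+m n i) i+n≤j+1)
    x₁≡0 : northX p (suc i) ≡ 0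
    x₁≡0 = trans (cong (northX p ∘ suc) i≡0) (northX-first 0<n)
    xⱼ≡m : northX p (suc j) ≡ m
    xⱼ≡m = *-cancelʳ-≡ _ _ n (+-cancelˡ-≡ (n + m) _ _ (begin
      n + m + northX p (suc j) * n    ≡⟨ e₁ n m (northX p (suc j)) ⟩
      suc (northX p (suc j)) * n + 1 * m
        ≡⟨ cong (λ i′ → suc (northX p (suc j)) * n + suc i′ * m) i≡0 ⟨
      suc (northX p (suc j)) * n + suc i * m
        ≡⟨ lin ⟨
      suc (northX p (suc i)) * n + suc (suc j) * m
        ≡⟨ cong₂ (λ x k → suc x * n + suc k * m) x₁≡0 j+1≡n ⟩
      1 * n + suc n * m               ≡⟨ e₂ n m ⟩
      n + m + m * n                   ∎))
      where
      open ≡-Reasoning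
      e₁ : ∀ n m x → n + m + x * n ≡ suc x * n + 1 * m
      e₁ = ℕ-Solver.solve-∀
      e₂ : ∀ n m → 1 * n + suc n * m ≡ n + m + m * n
      e₂ = ℕ-Solver.solve-∀

  rank-unseparated : ∀ p → IsDyck m n p → isStretched p ≡ false →
    ∃ λ k → k ∈ rankList m n p × (k ℤ.+ + m) ∈ rankList m n p
  rank-unseparated p d s with not-stretched 0 p s
  ... | inj₁ (i , i+1< , xᵢ≡xᵢ₊₁) = pathRank p (suc i) , ∈-rankList⁺ p (<-trans (n<1+n i) i+1<n)
      , subst (_∈ rankList m n p) (sym rank+m) (∈-rankList⁺ p i+1<n)
    where
    i+1<n : suc i < n
    i+1<n = subst (suc i <_) (IsDyck.norths≡ d) i+1<
    rank+m : pathRank p (suc i) ℤ.+ + m ≡ pathRank p (suc (suc i))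
    rank+m = begin
      pathRank p (suc i) ℤ.+ + m
        ≡⟨ cong (ℤ._+ + m) (pathRank≡ p (suc i) (row≤ (<-trans (n<1+n i) i+1<n))) ⟩
      (+ (suc i * m) ℤ.- + (suc (northX p (suc i)) * n + m)) ℤ.+ + m
        ≡⟨ −+≡+− (suc i * m) (suc (northX p (suc i)) * n + m) m ⟩
      + (suc i * m + m) ℤ.- + (suc (northX p (suc i)) * n + m)
        ≡⟨ cong₂ (λ a x → + a ℤ.- + (suc x * n + m)) (+-comm (suc i * m) m) xᵢ≡xᵢ₊₁ ⟩
      + (suc (suc i) * m) ℤ.- + (suc (northX p (suc (suc i))) * n + m)
        ≡⟨ pathRank≡ p (suc (suc i)) (row≤ i+1<n) ⟨
      pathRank p (suc (suc i)) ∎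
      where open ≡-Reasoning
  ... | inj₂ (k , norths≡ , xₖ≡) = ⊥-elim (<⇒≢ (IsDyckRows.northX-< d (<-trans 0<n n<m) k k<n)
      (trans xₖ≡ (IsDyck.easts≡ d)))
    where
    k<n : k < n
    k<n = subst (k <_) (trans (sym norths≡) (IsDyck.norths≡ d)) (n<1+n k)

  isClose-pathRank : ∀ p j L H → suc j + L < n → northX p (suc (suc j + L)) ≡ northX p (suc j) + H →
    isClose m (pathRank p (suc (suc j + L))) (pathRank p (suc j)) ≡ ((m * L <ᵇ n * H) ∧ (n * H <ᵇ m * suc (suc L)))
  isClose-pathRank p j L H k<n xₖ≡ = begin
    isClose m (pathRank p (suc k)) (pathRank p (suc j))
      ≡⟨ cong₂ (isClose m) (pathRank≡ p (suc k) (row≤ k<n))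
                           (pathRank≡ p (suc j) (row≤ (<-≤-trans (m≤m+n (suc j) L) (<⇒≤ k<n)))) ⟩
    isClose m (+ (suc k * m) ℤ.- + (suc xₖ * n + m)) (+ (suc j * m) ℤ.- + (suc xⱼ * n + m))
      ≡⟨ isClose-− m (suc k * m) (suc xₖ * n + m) (suc j * m) (suc xⱼ * n + m) ⟩
    (suc k * m + (suc xⱼ * n + m) <ᵇ suc j * m + m + (suc xₖ * n + m))
      ∧ (suc j * m + (suc xₖ * n + m) <ᵇ suc k * m + m + (suc xⱼ * n + m))
      ≡⟨ cong₂ _∧_ (trans (cong₂ _<ᵇ_ (e₁ j L m xⱼ n) (trans (cong (λ x → suc j * m + m + (suc x * n + m)) xₖ≡) (e₂ j m xⱼ H n)))
                          (<ᵇ-cancelʳ (m * L) (n * H) _))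
                   (trans (cong₂ _<ᵇ_ (trans (cong (λ x → suc j * m + (suc x * n + m)) xₖ≡) (e₃ j m xⱼ H n)) (e₄ j L m xⱼ n))
                          (<ᵇ-cancelʳ (n * H) (m * suc (suc L)) _)) ⟩
    (m * L <ᵇ n * H) ∧ (n * H <ᵇ m * suc (suc L)) ∎
    where
    open ≡-Reasoning
    k = suc j + L
    xₖ = northX p (suc k)
    xⱼ = northX p (suc j)
    e₁ : ∀ j L m x n → suc (suc j + L) * m + (suc x * n + m) ≡ m * L + (suc (suc j) * m + suc x * n + m)
    e₁ = ℕ-Solver.solve-∀
    e₂ : ∀ j m x H n → suc j * m + m + (suc (x + H) * n + m) ≡ n * H + (suc (suc j) * m + suc x * n + m)
    e₂ = ℕ-Solver.solve-∀
    e₃ : ∀ j m x H n → suc j * m + (suc (x + H) * n + m) ≡ n * H + (suc j * m + suc x * n + m)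
    e₃ = ℕ-Solver.solve-∀
    e₄ : ∀ j L m x n → suc (suc j + L) * m + m + (suc x * n + m) ≡ m * suc (suc L) + (suc j * m + suc x * n + m)
    e₄ = ℕ-Solver.solve-∀

-- Area

-- Row k+1 of the area of a path whose north step in that row is at x: `suc i * n + a < suc k * a`
-- says that the rank of the cell (i+1, k+1) is positive.
areaRow : ℕ → ℕ → ℕ → ℕ → ℕ
areaRow a n x k = ∑[ i < a ] 𝟙 (not (suc i ≤ᵇ x) ∧ (suc i * n + a <ᵇ suc k * a))

area≡∑areaRow : ∀ a n p → area a n p ≡ ∑[ k < n ] areaRow a n (northX p (suc k)) k
area≡∑areaRow a n p = trans (count-cells a n _) (∑-cong n (λ k k<n → ∑-cong a (λ i _ →
  cong (λ b → 𝟙 (not (suc i ≤ᵇ northX p (suc k)) ∧ b)) (positive k<n i))))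
  where
  positive : ∀ {k} → k < n → ∀ i → does (+ 0 ℤ.<? rank a n (suc i) (suc k)) ≡ (suc i * n + a <ᵇ suc k * a)
  positive {k} k<n i = trans (cong (λ r → does (+ 0 ℤ.<? r)) (rank≡ a n (suc i) (suc k) (s≤s (<⇒≤ k<n))))
    (trans (does-⇔ (−<−⇔ 0 0 (suc k * a) (suc i * n + a)) (+ 0 ℤ.<? _) (suc i * n + a <? suc k * a + 0))
      (cong (suc i * n + a <ᵇ_) (+-identityʳ (suc k * a))))

-- In row k+1 the stretched path lies k columns further east: of the m′ + n columns, the first k lie
-- above the path, the next m′ match the columns of the (m′,n)-diagram, and the last n − k have rank ≤ 0.
areaRow-stretch : ∀ m′ n k y → k < n → areaRow (m′ + n) n (y + k) k ≡ areaRow m′ n y k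
areaRow-stretch m′ n k y k<n with t , refl ← m≤n⇒∃[o]m+o≡n (<⇒≤ k<n) = begin
  ∑ (m′ + (k + t)) f                                   ≡⟨ cong (λ l → ∑ l f) (e₀ m′ k t) ⟩
  ∑ (k + m′ + t) f                                     ≡⟨ ∑-split f (k + m′) t ⟩
  ∑ (k + m′) f + ∑[ i < t ] f (k + m′ + i)             ≡⟨ cong₂ _+_ (∑-split f k m′) (∑-zero t beyond) ⟩
  ∑ k f + ∑[ i < m′ ] f (k + i) + 0                    ≡⟨ cong (_+ 0) (cong₂ _+_ (∑-zero k west) (∑-cong m′ shifted)) ⟩
  0 + ∑ m′ g + 0                                       ≡⟨ +-identityʳ _ ⟩
  ∑ m′ g                                               ∎
  where
  open ≡-Reasoning
  m = m′ + n
  f g : ℕ → ℕ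
  f i = 𝟙 (not (suc i ≤ᵇ y + k) ∧ (suc i * n + m <ᵇ suc k * m))
  g i = 𝟙 (not (suc i ≤ᵇ y) ∧ (suc i * n + m′ <ᵇ suc k * m′))
  e₀ : ∀ m′ k t → m′ + (k + t) ≡ k + m′ + t
  e₀ = ℕ-Solver.solve-∀
  west : ∀ i → i < k → f i ≡ 0
  west i i<k = cong (λ b → 𝟙 (not b ∧ (suc i * n + m <ᵇ suc k * m))) (dec-true (suc i ≤? y + k) (≤-trans i<k (m≤n+m k y)))
  beyond : ∀ i → i < t → f (k + m′ + i) ≡ 0
  beyond i _ = trans (cong (λ b → 𝟙 (not (suc (k + m′ + i) ≤ᵇ y + k) ∧ b))
      (dec-false (_ <? _) (≤⇒≯ (subst (suc k * m ≤_) (e₁ k t m′ i) (m≤m+n (suc k * m) _)))))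
    (cong 𝟙 (∧-zeroʳ _))
    where
    e₁ : ∀ k t m′ i → suc k * (m′ + (k + t)) + (m′ * t + k + t + i * (k + t))
                      ≡ suc (k + m′ + i) * (k + t) + (m′ + (k + t))
    e₁ = ℕ-Solver.solve-∀
  shifted : ∀ i → i < m′ → f (k + i) ≡ g i
  shifted i _ = cong₂ (λ b c → 𝟙 (not b ∧ c))
    (does-⇔ (mk⇔ (λ h → +-cancelʳ-≤ k (suc i) y (subst (_≤ y + k) (e₂ k i) h))
                 (λ h → subst (_≤ y + k) (sym (e₂ k i)) (+-monoˡ-≤ k h))) (suc (k + i) ≤? y + k) (suc i ≤? y))
    (trans (cong₂ _<ᵇ_ (e₃ k t m′ i) (e₄ k t m′)) (<ᵇ-cancelʳ (suc i * n + m′) (suc k * m′) (suc k * n)))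
    where
    e₂ : ∀ k i → suc (k + i) ≡ suc i + k
    e₂ = ℕ-Solver.solve-∀
    e₃ : ∀ k t m′ i → suc (k + i) * (k + t) + (m′ + (k + t)) ≡ suc i * (k + t) + m′ + suc k * (k + t)
    e₃ = ℕ-Solver.solve-∀
    e₄ : ∀ k t m′ → suc k * (m′ + (k + t)) ≡ suc k * m′ + suc k * (k + t)
    e₄ = ℕ-Solver.solve-∀

area-stretch : ∀ m n q → n ≤ m → IsDyck (m ∸ n) n q → area m n (stretch q) ≡ area (m ∸ n) n q
area-stretch m n q n≤m d = begin
  area m n (stretch q)                                          ≡⟨ area≡∑areaRow m n (stretch q) ⟩
  ∑[ k < n ] areaRow m n (northX (stretch q) (suc k)) k         ≡⟨ ∑-cong n row ⟩
  ∑[ k < n ] areaRow (m ∸ n) n (northX q (suc k)) k             ≡⟨ area≡∑areaRow (m ∸ n) n q ⟨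
  area (m ∸ n) n q                                              ∎
  where
  open ≡-Reasoning
  row : ∀ k → k < n → areaRow m n (northX (stretch q) (suc k)) k ≡ areaRow (m ∸ n) n (northX q (suc k)) k
  row k k<n = begin
    areaRow m n (northX (stretch q) (suc k)) k
      ≡⟨ cong₂ (λ a x → areaRow a n x k) (sym (m∸n+n≡m n≤m))
               (northX-stretch q k (subst (k <_) (sym (IsDyck.norths≡ d)) k<n)) ⟩
    areaRow (m ∸ n + n) n (northX q (suc k) + k) k
      ≡⟨ areaRow-stretch (m ∸ n) n k (northX q (suc k)) k<n ⟩
    areaRow (m ∸ n) n (northX q (suc k)) k ∎

-- dinv

-- `isDinvCell a n p c` unfolds to `isAbove p c ∧ isDinvArmLeg a n (arm a n p c) (leg a n p c)`.
isDinvArmLeg : ℕ → ℕ → ℕ → ℕ → Bool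
isDinvArmLeg a n A L = (A * n <ᵇ a * suc L) ∧ ((L ≡ᵇ 0) ∨ (a * L <ᵇ n * suc A))

long-arm⇒leg-test : ∀ a n A L → 0 < a → (suc A * n <ᵇ a * suc L) ≡ false → ((L ≡ᵇ 0) ∨ (a * L <ᵇ n * suc A)) ≡ true
long-arm⇒leg-test a n A zero _ _ = refl
long-arm⇒leg-test a n A (suc L) 0<a long = dec-true (a * suc L <? n * suc A)
  (<-≤-trans (*-monoʳ-< a {{>-nonZero 0<a}} (n<1+n (suc L)))
    (≤-trans (≮⇒≥ (does≡false⇒ (suc A * n <? a * suc (suc L)) long)) (≤-reflexive (*-comm (suc A) n))))

-- Passing from slope m/n to (m − n)/n and from arm A to A − L preserves the dinv test, except for
-- the cells with A n < m (L + 1) ≤ (A + 1) n, which pass it only for m/n.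
isDinvArmLeg-shift : ∀ m n A L → n < m → L ≤ A →
  𝟙 (isDinvArmLeg m n A L) ≡ 𝟙 (isDinvArmLeg (m ∸ n) n (A ∸ L) L) + 𝟙 ((A * n <ᵇ m * suc L) ∧ (m * suc L ≤ᵇ suc A * n))
isDinvArmLeg-shift m n A L n<m L≤A
  with m′ , refl ← m≤n⇒∃[o]m+o≡n (<⇒≤ n<m) | t , refl ← m≤n⇒∃[o]m+o≡n L≤A
  rewrite m+n∸m≡n n m′ | m+n∸m≡n L t = begin
    𝟙 (a ∧ C)                      ≡⟨ split a b C b⇒a a∧¬b⇒C ⟩
    𝟙 (b ∧ C) + 𝟙 (a ∧ not b)      ≡⟨ cong₂ _+_ (cong 𝟙 (cong₂ _∧_ (sym b≡) (cong (_∨_ (L ≡ᵇ 0)) (sym C≡))))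
                                             (cong (λ z → 𝟙 (a ∧ z)) (not-<ᵇ (suc (L + t) * n) x)) ⟩
    𝟙 (isDinvArmLeg m′ n t L) + 𝟙 (a ∧ (x ≤ᵇ suc (L + t) * n)) ∎
  where
  open ≡-Reasoning
  x = (n + m′) * suc L
  a = (L + t) * n <ᵇ x
  b = suc (L + t) * n <ᵇ x
  C = (L ≡ᵇ 0) ∨ ((n + m′) * L <ᵇ n * suc (L + t))
  split : ∀ a b c → (b ≡ true → a ≡ true) → (a ≡ true → b ≡ false → c ≡ true) →
    𝟙 (a ∧ c) ≡ 𝟙 (b ∧ c) + 𝟙 (a ∧ not b)
  split true true c _ _ = sym (+-identityʳ (𝟙 c))
  split true false c _ a∧¬b⇒c rewrite a∧¬b⇒c refl refl = refl
  split false true c b⇒a _ with () ← b⇒a refl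
  split false false c _ _ = refl
  b≡ : (t * n <ᵇ m′ * suc L) ≡ b
  b≡ = trans (sym (<ᵇ-cancelʳ (t * n) (m′ * suc L) (n * suc L))) (cong₂ _<ᵇ_ (e₁ t n L) (e₂ m′ n L))
    where
    e₁ : ∀ t n L → t * n + n * suc L ≡ suc (L + t) * n
    e₁ = ℕ-Solver.solve-∀
    e₂ : ∀ m′ n L → m′ * suc L + n * suc L ≡ (n + m′) * suc L
    e₂ = ℕ-Solver.solve-∀
  C≡ : (m′ * L <ᵇ n * suc t) ≡ ((n + m′) * L <ᵇ n * suc (L + t))
  C≡ = trans (sym (<ᵇ-cancelʳ (m′ * L) (n * suc t) (n * L))) (cong₂ _<ᵇ_ (e₁ m′ n L) (e₂ n t L))
    where
    e₁ : ∀ m′ n L → m′ * L + n * L ≡ (n + m′) * L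
    e₁ = ℕ-Solver.solve-∀
    e₂ : ∀ n t L → n * suc t + n * L ≡ n * suc (L + t)
    e₂ = ℕ-Solver.solve-∀
  b⇒a : b ≡ true → a ≡ true
  b⇒a b = dec-true ((L + t) * n <? x) (≤-<-trans (m≤n+m ((L + t) * n) n) (does≡true⇒ (_ <? x) b))
  a∧¬b⇒C : a ≡ true → b ≡ false → C ≡ true
  a∧¬b⇒C _ = long-arm⇒leg-test (n + m′) n (L + t) L (≤-<-trans z≤n n<m)

∑-isDinvArmLeg-shift : ∀ m n D LO L → n < m → L ≤ LO →
  ∑[ i < suc D ] 𝟙 (isDinvArmLeg m n (D + LO ∸ i) L)
  ≡ ∑[ i < D ] 𝟙 (isDinvArmLeg (m ∸ n) n (D + LO ∸ suc i ∸ L) L)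
    + (𝟙 (isDinvArmLeg m n (D + LO) L) + 𝟙 ((LO * n <ᵇ m * suc L) ∧ (m * suc L ≤ᵇ (D + LO) * n)))
∑-isDinvArmLeg-shift m n D LO L n<m L≤LO = begin
  first + ∑[ i < D ] 𝟙 (isDinvArmLeg m n (D + LO ∸ suc i) L)
    ≡⟨ cong (_+_ first) (∑-cong D (λ i i<D → isDinvArmLeg-shift m n (D + LO ∸ suc i) L n<m (≤-trans L≤LO (LO≤ i<D)))) ⟩
  first + ∑[ i < D ] (shifted i + interval i)
    ≡⟨ cong (_+_ first) (∑-distrib-+ shifted interval D) ⟩
  first + (∑ D shifted + ∑ D interval)
    ≡⟨ cong (λ z → first + (∑ D shifted + z)) (∑-consecutive-intervals n (m * suc L) (D + LO) D (m≤m+n D LO)) ⟩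
  first + (∑ D shifted + 𝟙 (((D + LO ∸ D) * n <ᵇ m * suc L) ∧ (m * suc L ≤ᵇ (D + LO) * n)))
    ≡⟨ cong (λ z → first + (∑ D shifted + 𝟙 ((z * n <ᵇ m * suc L) ∧ (m * suc L ≤ᵇ (D + LO) * n)))) (m+n∸m≡n D LO) ⟩
  first + (∑ D shifted + 𝟙 ((LO * n <ᵇ m * suc L) ∧ (m * suc L ≤ᵇ (D + LO) * n)))
    ≡⟨ x+[y+z]≡y+[x+z] first (∑ D shifted) _ ⟩
  ∑ D shifted + (first + 𝟙 ((LO * n <ᵇ m * suc L) ∧ (m * suc L ≤ᵇ (D + LO) * n))) ∎
  where
  open ≡-Reasoning
  first = 𝟙 (isDinvArmLeg m n (D + LO) L)
  shifted interval : ℕ → ℕ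
  shifted i = 𝟙 (isDinvArmLeg (m ∸ n) n (D + LO ∸ suc i ∸ L) L)
  interval i = 𝟙 ((((D + LO) ∸ suc i) * n <ᵇ m * suc L) ∧ (m * suc L ≤ᵇ suc (D + LO ∸ suc i) * n))
  LO≤ : ∀ {i} → i < D → LO ≤ D + LO ∸ suc i
  LO≤ {i} i<D = subst (_≤ D + LO ∸ suc i) (m+n∸m≡n D LO) (∸-monoʳ-≤ (D + LO) i<D)
  x+[y+z]≡y+[x+z] : ∀ x y z → x + (y + z) ≡ y + (x + z)
  x+[y+z]≡y+[x+z] = ℕ-Solver.solve-∀

private
  n*suc≡ : ∀ n h → n * suc h ≡ h * n + n
  n*suc≡ = ℕ-Solver.solve-∀

  short⇒next-short : ∀ m n h L → n < m → h * n < m * suc L → n * suc h < m * suc (suc L)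
  short⇒next-short m n h L n<m short = subst₂ _<_ (sym (n*suc≡ n h)) (trans (+-comm (m * suc L) m) (sym (*-suc m (suc L))))
    (+-mono-<-≤ short (<⇒≤ n<m))

  short⇒LO-short : ∀ n h LO x → LO ≤ h → h * n < x → n * LO < x
  short⇒LO-short n h LO x LO≤h short = ≤-<-trans (≤-trans (*-monoʳ-≤ n LO≤h) (≤-reflexive (*-comm n h))) short

  long⇒leg-short : ∀ m n h L → 0 < m → m * suc L ≤ h * n → m * L < n * suc h
  long⇒leg-short m n h L 0<m long = <-≤-trans (*-monoʳ-< m {{>-nonZero 0<m}} (n<1+n L))
    (≤-trans long (subst (h * n ≤_) (sym (n*suc≡ n h)) (m≤m+n (h * n) n)))

  leg-test≡ : ∀ m n h L → 0 < n → ((L ≡ᵇ 0) ∨ (m * L <ᵇ n * suc h)) ≡ (m * L <ᵇ n * suc h)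
  leg-test≡ m n h zero 0<n = sym (dec-true (m * 0 <? n * suc h)
    (subst₂ _<_ (sym (*-zeroʳ m)) (sym (n*suc≡ n h)) (<-≤-trans 0<n (m≤n+m n (h * n)))))
  leg-test≡ m n h (suc L) 0<n = refl

isDinvArmLeg-boundary : ∀ m n h LO L → 0 < n → n < m → LO ≤ h →
  𝟙 (isDinvArmLeg m n h L) + 𝟙 ((LO * n <ᵇ m * suc L) ∧ (m * suc L ≤ᵇ h * n)) + 𝟙 (n * suc h <ᵇ m * suc (suc L))
  ≡ 𝟙 ((m * L <ᵇ n * suc h) ∧ (n * suc h <ᵇ m * suc (suc L))) + 𝟙 (n * LO <ᵇ m * suc L)
isDinvArmLeg-boundary m n h LO L 0<n n<m LO≤h with h * n <? m * suc L
... | yes short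
  rewrite dec-true (h * n <? m * suc L) short | dec-false (m * suc L ≤? h * n) (<⇒≱ short)
        | dec-true (n * suc h <? m * suc (suc L)) (short⇒next-short m n h L n<m short)
        | dec-true (n * LO <? m * suc L) (short⇒LO-short n h LO (m * suc L) LO≤h short)
        | ∧-zeroʳ (LO * n <ᵇ m * suc L) | ∧-identityʳ (m * L <ᵇ n * suc h)
  = cong (_+ 1) (trans (+-identityʳ _) (cong 𝟙 (leg-test≡ m n h L 0<n)))
... | no long
  rewrite dec-false (h * n <? m * suc L) long | dec-true (m * suc L ≤? h * n) (≮⇒≥ long)
        | dec-true (m * L <? n * suc h) (long⇒leg-short m n h L (<-trans 0<n n<m) (≮⇒≥ long))
        | ∧-identityʳ (LO * n <ᵇ m * suc L) | *-comm LO n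
  = +-comm (𝟙 (n * LO <ᵇ m * suc L)) _

-- Block j of row k+1 (leg L = k − j − 1), with D = y_{j+2} − y_{j+1} and E = y_{k+1} − y_{j+2} for the
-- north x-coordinates y of q: stretched, the block gains a cell and its arms grow by L + 1; it then differs
-- from the block of q by the closeness of the ranks of rows j+1 and k+1, up to boundary terms.
dinvBlock-stretch : ∀ m n D E L → 0 < n → n < m →
  ∑[ i < suc D ] 𝟙 (isDinvArmLeg m n (D + (E + L) ∸ i) L) + 𝟙 (n * suc (D + (E + L)) <ᵇ m * suc (suc L))
  ≡ ∑[ i < D ] 𝟙 (isDinvArmLeg (m ∸ n) n (D + E ∸ suc i) L)
    + 𝟙 ((m * L <ᵇ n * suc (D + (E + L))) ∧ (n * suc (D + (E + L)) <ᵇ m * suc (suc L)))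
    + 𝟙 (n * (E + L) <ᵇ m * suc L)
dinvBlock-stretch m n D E L 0<n n<m = begin
  ∑[ i < suc D ] 𝟙 (isDinvArmLeg m n (h ∸ i) L) + next
    ≡⟨ cong (_+ next) (∑-isDinvArmLeg-shift m n D (E + L) L n<m (m≤n+m L E)) ⟩
  ∑[ i < D ] 𝟙 (isDinvArmLeg (m ∸ n) n (h ∸ suc i ∸ L) L) + (first + interval) + next
    ≡⟨ +-assoc (∑[ i < D ] 𝟙 (isDinvArmLeg (m ∸ n) n (h ∸ suc i ∸ L) L)) (first + interval) next ⟩
  ∑[ i < D ] 𝟙 (isDinvArmLeg (m ∸ n) n (h ∸ suc i ∸ L) L) + (first + interval + next)
    ≡⟨ cong₂ _+_ (∑-cong D (λ i i<D → cong (λ A → 𝟙 (isDinvArmLeg (m ∸ n) n A L)) (drop-leg i<D)))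
                 (isDinvArmLeg-boundary m n h (E + L) L 0<n n<m (m≤n+m (E + L) D)) ⟩
  ∑[ i < D ] 𝟙 (isDinvArmLeg (m ∸ n) n (D + E ∸ suc i) L) + (close + 𝟙 (n * (E + L) <ᵇ m * suc L))
    ≡⟨ +-assoc (∑[ i < D ] 𝟙 (isDinvArmLeg (m ∸ n) n (D + E ∸ suc i) L)) close _ ⟨
  ∑[ i < D ] 𝟙 (isDinvArmLeg (m ∸ n) n (D + E ∸ suc i) L) + close + 𝟙 (n * (E + L) <ᵇ m * suc L) ∎
  where
  open ≡-Reasoning
  h = D + (E + L)
  next = 𝟙 (n * suc h <ᵇ m * suc (suc L))
  first = 𝟙 (isDinvArmLeg m n h L)
  interval = 𝟙 (((E + L) * n <ᵇ m * suc L) ∧ (m * suc L ≤ᵇ h * n))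
  close = 𝟙 ((m * L <ᵇ n * suc h) ∧ (n * suc h <ᵇ m * suc (suc L)))
  drop-leg : ∀ {i} → i < D → h ∸ suc i ∸ L ≡ D + E ∸ suc i
  drop-leg {i} i<D = begin
    D + (E + L) ∸ suc i ∸ L     ≡⟨ cong (λ z → z ∸ suc i ∸ L) (+-assoc D E L) ⟨
    D + E + L ∸ suc i ∸ L       ≡⟨ cong (_∸ L) (+-∸-comm L (≤-trans i<D (m≤m+n D E))) ⟩
    D + E ∸ suc i + L ∸ L       ≡⟨ m+n∸n≡m _ L ⟩
    D + E ∸ suc i               ∎

module DinvRows {a n p} (d : IsDyck a n p) (0<n : 0 < n) (0<a : 0 < a) where

  open IsDyckRows d public

  private
    X = northX p

  arm≡ : ∀ u v → u ≤ X v → X v ≤ a → arm a n p (u , v) ≡ X v ∸ u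
  arm≡ u v u≤ ≤a = trans (count-range1 _ a)
    (trans (∑-cong a (λ i _ → cong (λ b → 𝟙 (b ∧ (i <ᵇ X v))) (<ᵇ-suc u i))) (∑-interval a u (X v) u≤ ≤a))
    where
    <ᵇ-suc : ∀ u i → (u <ᵇ suc i) ≡ (u ≤ᵇ i)
    <ᵇ-suc zero i = refl
    <ᵇ-suc (suc u) i = refl

  leg≡ : ∀ u j k → j < k → k < n → X (suc j) < u → u ≤ X (suc (suc j)) → leg a n p (u , suc k) ≡ k ∸ suc j
  leg≡ u j k j<k k<n below above = trans (count-range1 _ n)
    (trans (∑-cong n (λ i i<n → cong 𝟙 (trans (∧-comm (i <ᵇ k) _) (cong (_∧ (i <ᵇ k)) (column i i<n)))))
      (∑-interval n (suc j) k j<k (<⇒≤ k<n)))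
    where
    column : ∀ i → i < n → (u ≤ᵇ X (suc i)) ≡ (suc j ≤ᵇ i)
    column i i<n with suc j ≤? i
    ... | yes j<i = trans (dec-true (u ≤? X (suc i)) (≤-trans above (northX-mono (suc j) i j<i i<n)))
                          (sym (dec-true (suc j ≤? i) j<i))
    ... | no j≮i = trans
      (dec-false (u ≤? X (suc i)) (<⇒≱ (≤-<-trans (northX-mono i j (≤-pred (≰⇒> j≮i)) (<-trans j<k k<n)) below)))
                         (sym (dec-false (suc j ≤? i) j≮i))

  -- The cells of row k+1 above the path lying between the north steps of rows j+1 and j+2 all have leg k − j − 1.
  dinvBlock : ℕ → ℕ → ℕ
  dinvBlock k j = ∑[ i < X (suc (suc j)) ∸ X (suc j) ] 𝟙 (isDinvArmLeg a n (X (suc k) ∸ (X (suc j) + suc i)) (k ∸ suc j))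

  dinvRow≡ : ∀ k → k < n → ∑[ i < a ] 𝟙 (isDinvCell a n p (suc i , suc k)) ≡ ∑[ j < k ] dinvBlock k j
  dinvRow≡ k k<n = begin
    ∑ a f
      ≡⟨ cong (λ l → ∑ l f) (m+[n∸m]≡n x≤a) ⟨
    ∑ (x + (a ∸ x)) f
      ≡⟨ ∑-split f x (a ∸ x) ⟩
    ∑ x f + ∑[ i < a ∸ x ] f (x + i)
      ≡⟨ cong₂ _+_ (∑-cong x above) (∑-zero (a ∸ x) below) ⟩
    ∑ x g + 0
      ≡⟨ +-identityʳ _ ⟩
    ∑ x g
      ≡⟨ ∑-blocks g (X ∘ suc) k (northX-first 0<n) (λ j j<k → northX-mono j (suc j) (n≤1+n j) (≤-<-trans j<k k<n)) ⟩
    ∑[ j < k ] ∑[ i < X (suc (suc j)) ∸ X (suc j) ] g (X (suc j) + i)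
      ≡⟨ ∑-cong k (λ j j<k → ∑-cong _ (block j j<k)) ⟩
    ∑[ j < k ] dinvBlock k j ∎
    where
    open ≡-Reasoning
    x = X (suc k)
    x≤a = <⇒≤ (northX-< 0<a k k<n)
    f g : ℕ → ℕ
    f i = 𝟙 (isDinvCell a n p (suc i , suc k))
    armLeg : ℕ → Bool
    armLeg i = isDinvArmLeg a n (arm a n p (suc i , suc k)) (leg a n p (suc i , suc k))
    g i = 𝟙 (armLeg i)
    above : ∀ i → i < x → f i ≡ g i
    above i i<x = cong (λ b → 𝟙 (b ∧ armLeg i)) (dec-true (suc i ≤? x) i<x)
    below : ∀ i → i < a ∸ x → f (x + i) ≡ 0
    below i _ = cong (λ b → 𝟙 (b ∧ armLeg (x + i))) (dec-false (suc (x + i) ≤? x) (<⇒≱ (s≤s (m≤m+n x i))))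
    block : ∀ j → j < k → ∀ i → i < X (suc (suc j)) ∸ X (suc j) →
      g (X (suc j) + i) ≡ 𝟙 (isDinvArmLeg a n (x ∸ (X (suc j) + suc i)) (k ∸ suc j))
    block j j<k i i< = cong₂ (λ A L → 𝟙 (isDinvArmLeg a n A L))
      (trans (cong (λ u → arm a n p (u , suc k)) u≡) (arm≡ u (suc k) (≤-trans u≤next (northX-mono (suc j) k j<k k<n)) x≤a))
      (trans (cong (λ u → leg a n p (u , suc k)) u≡) (leg≡ u j k j<k k<n (m<m+n _ (s≤s z≤n)) u≤next))
      where
      u = X (suc j) + suc i
      u≡ : suc (X (suc j) + i) ≡ u
      u≡ = sym (+-suc _ i)
      u≤next : u ≤ X (suc (suc j))
      u≤next = subst (u ≤_) (m+[n∸m]≡n (northX-mono j (suc j) (n≤1+n j) (≤-<-trans j<k k<n))) (+-monoʳ-≤ (X (suc j)) i<)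

  dinv≡ : dinv a n p ≡ ∑[ k < n ] ∑[ j < k ] dinvBlock k j
  dinv≡ = trans (count-cells a n (isDinvCell a n p)) (∑-cong n dinvRow≡)

module DinvStretch (m n : ℕ) (0<n : 0 < n) (n<m : n < m) (cop : Coprime m n) {q} (dq : IsDyck (m ∸ n) n q) where

  open PathRanks m n 0<n n<m cop using (pathRank; isClose-pathRank)

  private
    p = stretch q
    dp : IsDyck m n p
    dp = IsDyck-stretch m n q (<⇒≤ n<m) dq
    module P = DinvRows dp 0<n (<-trans 0<n n<m)
    module Q = DinvRows dq 0<n (m<n⇒0<n∸m n<m)
    X Y : ℕ → ℕ
    X = northX p
    Y = northX q
    X≡Y+ : ∀ i → i < n → X (suc i) ≡ Y (suc i) + i
    X≡Y+ i i<n = northX-stretch q i (subst (i <_) (sym (IsDyck.norths≡ dq)) i<n)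

  -- The boundary term carried from block j to block j+1 of row k+1.
  boundary : ℕ → ℕ → ℕ
  boundary k j = 𝟙 (n * (X (suc k) ∸ X (suc j)) <ᵇ m * suc (k ∸ j))

  closeRanks : ℕ → ℕ → ℕ
  closeRanks k j = 𝟙 (isClose m (pathRank p (suc k)) (pathRank p (suc j)))

  X-offsets : ∀ j L D E → suc j + L < n → Y (suc j) + D ≡ Y (suc (suc j)) → Y (suc (suc j)) + E ≡ Y (suc (suc j + L)) →
    X (suc (suc j)) ≡ X (suc j) + suc D × X (suc (suc j + L)) ≡ X (suc j) + suc (D + (E + L))
  X-offsets j L D E k<n Y₂≡ Y₃≡ = (begin
    X (suc (suc j))          ≡⟨ X≡Y+ (suc j) j+1<n ⟩
    Y (suc (suc j)) + suc j  ≡⟨ cong (_+ suc j) Y₂≡ ⟨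
    y + D + suc j            ≡⟨ e₁ y D j ⟩
    y + j + suc D            ≡⟨ cong (_+ suc D) z≡ ⟨
    X (suc j) + suc D        ∎) , (begin
    X (suc k)                ≡⟨ X≡Y+ k k<n ⟩
    Y (suc k) + k            ≡⟨ cong (_+ k) (trans (cong (_+ E) Y₂≡) Y₃≡) ⟨
    y + D + E + k            ≡⟨ e₂ y D E j L ⟩
    y + j + suc (D + (E + L)) ≡⟨ cong (_+ suc (D + (E + L))) z≡ ⟨
    X (suc j) + suc (D + (E + L)) ∎)
    where
    open ≡-Reasoning
    k = suc j + L
    y = Y (suc j)
    j+1<n : suc j < n
    j+1<n = ≤-<-trans (m≤m+n (suc j) L) k<n
    z≡ : X (suc j) ≡ y + j
    z≡ = X≡Y+ j (<-trans (n<1+n j) j+1<n)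
    e₁ : ∀ y D j → y + D + suc j ≡ y + j + suc D
    e₁ = ℕ-Solver.solve-∀
    e₂ : ∀ y D E j L → y + D + E + suc (j + L) ≡ y + j + suc (D + (E + L))
    e₂ = ℕ-Solver.solve-∀

  dinvBlock-step : ∀ {j k} → j < k → k < n →
    P.dinvBlock k j + boundary k j ≡ Q.dinvBlock k j + closeRanks k j + boundary k (suc j)
  dinvBlock-step {j} {k} j<k k<n
    with L , refl ← m≤n⇒∃[o]m+o≡n j<k
    with D , Y₂≡ ← m≤n⇒∃[o]m+o≡n (Q.northX-mono j (suc j) (n≤1+n j) (≤-<-trans (m≤m+n (suc j) L) k<n))
    with E , Y₃≡ ← m≤n⇒∃[o]m+o≡n (Q.northX-mono (suc j) (suc j + L) (m≤m+n (suc j) L) k<n) = begin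
    P.dinvBlock k j + boundary k j
      ≡⟨ cong₂ _+_ p-block p-boundary ⟩
    ∑[ i < suc D ] 𝟙 (isDinvArmLeg m n (h ∸ i) L) + 𝟙 (n * suc h <ᵇ m * suc (suc L))
      ≡⟨ dinvBlock-stretch m n D E L 0<n n<m ⟩
    ∑[ i < D ] 𝟙 (isDinvArmLeg (m ∸ n) n (D + E ∸ suc i) L)
      + 𝟙 ((m * L <ᵇ n * suc h) ∧ (n * suc h <ᵇ m * suc (suc L))) + 𝟙 (n * (E + L) <ᵇ m * suc L)
      ≡⟨ cong₂ _+_ (cong₂ _+_ q-block close) next-boundary ⟨
    Q.dinvBlock k j + closeRanks k j + boundary k (suc j) ∎
    where
    open ≡-Reasoning
    h = D + (E + L)
    y = Y (suc j)
    z = X (suc j)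
    X₂≡ : X (suc (suc j)) ≡ z + suc D
    X₂≡ = proj₁ (X-offsets j L D E k<n Y₂≡ Y₃≡)
    Xₖ≡ : X (suc k) ≡ z + suc h
    Xₖ≡ = proj₂ (X-offsets j L D E k<n Y₂≡ Y₃≡)
    Yₖ≡ : Y (suc k) ≡ y + (D + E)
    Yₖ≡ = trans (sym Y₃≡) (trans (cong (_+ E) (sym Y₂≡)) (+-assoc y D E))
    leg≡ : k ∸ suc j ≡ L
    leg≡ = m+n∸m≡n (suc j) L
    p-block : P.dinvBlock k j ≡ ∑[ i < suc D ] 𝟙 (isDinvArmLeg m n (h ∸ i) L)
    p-block = ∑-cong′ (trans (cong (_∸ z) X₂≡) (m+n∸m≡n z (suc D)))
      (λ i _ → cong₂ (λ A L′ → 𝟙 (isDinvArmLeg m n A L′))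
        (trans (cong (_∸ (z + suc i)) Xₖ≡) ([m+n]∸[m+o]≡n∸o z (suc h) (suc i))) leg≡)
    q-block : Q.dinvBlock k j ≡ ∑[ i < D ] 𝟙 (isDinvArmLeg (m ∸ n) n (D + E ∸ suc i) L)
    q-block = ∑-cong′ (trans (cong (_∸ y) (sym Y₂≡)) (m+n∸m≡n y D))
      (λ i _ → cong₂ (λ A L′ → 𝟙 (isDinvArmLeg (m ∸ n) n A L′))
        (trans (cong (_∸ (y + suc i)) Yₖ≡) ([m+n]∸[m+o]≡n∸o y (D + E) (suc i))) leg≡)
    p-boundary : boundary k j ≡ 𝟙 (n * suc h <ᵇ m * suc (suc L))
    p-boundary = cong₂ (λ H l → 𝟙 (n * H <ᵇ m * suc l))
      (trans (cong (_∸ z) Xₖ≡) (m+n∸m≡n z (suc h)))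
      (trans (cong (_∸ j) (sym (+-suc j L))) (m+n∸m≡n j (suc L)))
    next-boundary : boundary k (suc j) ≡ 𝟙 (n * (E + L) <ᵇ m * suc L)
    next-boundary = cong₂ (λ H l → 𝟙 (n * H <ᵇ m * suc l))
      (trans (cong₂ _∸_ Xₖ≡ X₂≡) (trans ([m+n]∸[m+o]≡n∸o z (suc h) (suc D)) (m+n∸m≡n D (E + L))))
      leg≡
    close : closeRanks k j ≡ 𝟙 ((m * L <ᵇ n * suc h) ∧ (n * suc h <ᵇ m * suc (suc L)))
    close = cong 𝟙 (isClose-pathRank p j L (suc h) k<n Xₖ≡)

  dinvRow-stretch : ∀ k → k < n → ∑[ j < k ] P.dinvBlock k j ≡ ∑[ j < k ] Q.dinvBlock k j + ∑[ j < k ] closeRanks k j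
  dinvRow-stretch k k<n = +-cancelʳ-≡ (∑ k (boundary k)) _ _ (begin
    ∑ k (P.dinvBlock k) + ∑ k (boundary k)
      ≡⟨ ∑-distrib-+ (P.dinvBlock k) (boundary k) k ⟨
    ∑[ j < k ] (P.dinvBlock k j + boundary k j)
      ≡⟨ ∑-cong k (λ j j<k → dinvBlock-step j<k k<n) ⟩
    ∑[ j < k ] (Q.dinvBlock k j + closeRanks k j + boundary k (suc j))
      ≡⟨ ∑-distrib-+ (λ j → Q.dinvBlock k j + closeRanks k j) (boundary k ∘ suc) k ⟩
    ∑[ j < k ] (Q.dinvBlock k j + closeRanks k j) + ∑[ j < k ] boundary k (suc j)
      ≡⟨ cong₂ _+_ (∑-distrib-+ (Q.dinvBlock k) (closeRanks k) k) (sym (∑-shift (boundary k) k (trans first (sym last)))) ⟩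
    ∑ k (Q.dinvBlock k) + ∑ k (closeRanks k) + ∑ k (boundary k) ∎)
    where
    open ≡-Reasoning
    0<m = <-trans 0<n n<m
    first : boundary k 0 ≡ 1
    first = cong 𝟙 (dec-true (_ <? _) (subst (λ x → n * (X (suc k) ∸ x) < m * suc k) (sym (P.northX-first 0<n))
      (≤-<-trans (P.northX-below k k<n) (*-monoʳ-< m {{>-nonZero 0<m}} (n<1+n k)))))
    last : boundary k k ≡ 1
    last = cong 𝟙 (dec-true (_ <? _) (subst₂ (λ x y → n * x < m * suc y) (sym (n∸n≡0 (X (suc k)))) (sym (n∸n≡0 k))
      (subst (_< m * 1) (sym (*-zeroʳ n)) (subst (0 <_) (sym (*-identityʳ m)) 0<m))))

  dinv-stretch : dinv m n (stretch q) ≡ dinv (m ∸ n) n q + closePairs m (rankList m n (stretch q))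
  dinv-stretch = begin
    dinv m n p                                                         ≡⟨ P.dinv≡ ⟩
    ∑[ k < n ] ∑[ j < k ] P.dinvBlock k j                              ≡⟨ ∑-cong n dinvRow-stretch ⟩
    ∑[ k < n ] (∑[ j < k ] Q.dinvBlock k j + ∑[ j < k ] closeRanks k j) ≡⟨ ∑-distrib-+ _ _ n ⟩
    ∑[ k < n ] ∑[ j < k ] Q.dinvBlock k j + ∑[ k < n ] ∑[ j < k ] closeRanks k j
      ≡⟨ cong₂ _+_ Q.dinv≡ (closePairs-range1 m (pathRank p) n) ⟨
    dinv (m ∸ n) n q + closePairs m (rankList m n p)                   ∎
    where open ≡-Reasoning

-- The Hikita coefficient

module Hikita (m n : ℕ) (0<n : 0 < n) (n<m : n < m) (cop : Coprime m n) where

  open PathRanks m n 0<n n<m cop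

  pathMonomial : Path → Monomial
  pathMonomial p = (+ dinv m n p ℤ.- + closePairs m (rankList m n p) , area m n p)

  fullDescentMonomials : ∀ p → p ∈ dyckPaths m n →
    map (λ W → (+ dinv m n p ℤ.- + inv m W , area m n p)) (fullDescentWords m n (rankList m n p))
    ≡ (if isStretched p then pathMonomial p ∷ [] else [])
  fullDescentMonomials p p∈ with isStretched p in s
  ... | true = trans (map-∘ (fullDescentWords m n (rankList m n p)))
      (cong (map (λ i → (+ dinv m n p ℤ.- + i , area m n p)))
        (fullDescentWords-separated m n (rankList m n p) (length-rankList p) (rankList-unique p) (rank-separated p d s)))
    where d = ∈-dyckPaths⁻ m n p∈
  ... | false with rank-unseparated p (∈-dyckPaths⁻ m n p∈) s
  ...   | k , k∈ , k+m∈ = cong (map _)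
      (fullDescentWords-unseparated m n (rankList m n p) (length-rankList p) (<-trans 0<n n<m) k∈ k+m∈)

  hikitaCoeff≡ : hikitaCoeff m n (fullSet n) ≡ map pathMonomial (filterᵇ isStretched (dyckPaths m n))
  hikitaCoeff≡ = begin
    map monomial (filterᵇ full (concatMap pairs (dyckPaths m n)))
      ≡⟨ cong (map monomial) (filterᵇ-concatMap full pairs (dyckPaths m n)) ⟩
    map monomial (concatMap (filterᵇ full ∘ pairs) (dyckPaths m n))
      ≡⟨ map-concatMap monomial (filterᵇ full ∘ pairs) (dyckPaths m n) ⟩
    concatMap (map monomial ∘ filterᵇ full ∘ pairs) (dyckPaths m n)
      ≡⟨ cong concat (map-cong-local (All.tabulate per-path)) ⟩
    concatMap (λ p → if isStretched p then pathMonomial p ∷ [] else []) (dyckPaths m n)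
      ≡⟨ concatMap-if isStretched pathMonomial (dyckPaths m n) ⟩
    map pathMonomial (filterᵇ isStretched (dyckPaths m n)) ∎
    where
    open ≡-Reasoning
    monomial : Path × List ℤ → Monomial
    monomial (p , W) = (+ dinv m n p ℤ.- + inv m W , area m n p)
    full : Path × List ℤ → Bool
    full (_ , W) = hasFullDescentSet n W
    pairs : Path → List (Path × List ℤ)
    pairs p = map (p ,_) (filterᵇ (validWord m (rankList m n p)) (perms (rankList m n p)))
    per-path : ∀ {p} → p ∈ dyckPaths m n →
      (map monomial ∘ filterᵇ full ∘ pairs) p ≡ (if isStretched p then pathMonomial p ∷ [] else [])
    per-path {p} p∈ = trans
      (cong (map monomial) (filterᵇ-map full (p ,_) (filterᵇ (validWord m (rankList m n p)) (perms (rankList m n p)))))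
      (trans (sym (map-∘ (fullDescentWords m n (rankList m n p)))) (fullDescentMonomials p p∈))

  pathMonomial-stretch : ∀ {q} → q ∈ dyckPaths (m ∸ n) n →
    pathMonomial (stretch q) ≡ (+ dinv (m ∸ n) n q , area (m ∸ n) n q)
  pathMonomial-stretch {q} q∈ = cong₂ _,_
    (trans (cong (λ d → + d ℤ.- + c) (DinvStretch.dinv-stretch m n 0<n n<m cop dq))
      (trans (cong (ℤ._- + c) (ℤₚ.pos-+ (dinv (m ∸ n) n q) c)) (cancel (+ dinv (m ∸ n) n q) (+ c))))
    (area-stretch m n q (<⇒≤ n<m) dq)
    where
    dq = ∈-dyckPaths⁻ (m ∸ n) n q∈
    c = closePairs m (rankList m n (stretch q))
    cancel : ∀ (A C : ℤ) → (A ℤ.+ C) ℤ.- C ≡ A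
    cancel = ℤ-Solver.solve-∀

mainTheorem2 : (m n : ℕ) → 0 < n → 0 < m → Coprime m n → n < m →
    hikitaCoeff m n (fullSet n) ↭ catalan (m ∸ n) n
mainTheorem2 m n 0<n _ cop n<m = begin
  hikitaCoeff m n (fullSet n)                                ≡⟨ hikitaCoeff≡ ⟩
  map pathMonomial (filterᵇ isStretched (dyckPaths m n))     ↭⟨ map⁺ pathMonomial (stretched-dyckPaths m n (<⇒≤ n<m)) ⟩
  map pathMonomial (map stretch (dyckPaths (m ∸ n) n))       ≡⟨ map-∘ (dyckPaths (m ∸ n) n) ⟨
  map (pathMonomial ∘ stretch) (dyckPaths (m ∸ n) n)         ≡⟨ map-cong-local (All.tabulate pathMonomial-stretch) ⟩
  catalan (m ∸ n) n                                          ∎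
  where
  open PermutationReasoning
  open Hikita m n 0<n n<m cop
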